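{- For every integer $k\ge 2$ we have $\Xi(k)\le 2k-2$. Moreover, $\lim_{k\to\infty}\frac{\Xi(k)}{k}=2$.
   Context: All graphs are finite, simple and undirected (no loops, no multiple edges). For a graph $G=(V,E)$ and $x\in V$, $N[x]=\{x\}\cup\{y\in V: xy\in E\}$ is the closed neighbourhood of $x$. A set $C\subseteq V$ is called identifying if for all distinct $X,Y\subseteq V$ with $|X|,|Y|\le 1$ we have $N[X]\cap C\ne N[Y]\cap C$, where $N[X]=\bigcup_{x\in X}N[x]$ (so $N[\emptyset]=\emptyset$); equivalently, $N[x]\cap C\neq\emptyset$ for every $x\in V$ and $N[x]\cap C\ne N[y]\cap C$ for all distinct $x,y\in V$. For integers $n\ge k\ge 1$, $\mathfrak{Gr}(n,k)$ denotes the set of graphs on $n$ vertices in which every $k$-element subset of vertices is identifying. $\Xi(k)=\max\{n\ge k:\mathfrak{Gr}(n,k)\neq\emptyset\}$. -}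

module Defs where

open import Data.Nat using (ℕ; _≤_)
open import Data.Bool using (Bool; true; false; _∨_)
open import Data.Fin using (Fin; _≟_)
open import Data.Fin.Subset using (Subset; ⊥; _∩_; ∣_∣; _∪_)
open import Data.Vec using (tabulate)
open import Data.Maybe using (Maybe; just; nothing)
open import Data.Product using (Σ; _×_; ∃)
open import Relation.Nullary using (¬_; does)
open import Relation.Binary.PropositionalEquality using (_≡_; _≢_)

record Graph (n : ℕ) : Set where
  field
    adj   : Fin n → Fin n → Bool
    irrefl : ∀ x → adj x x ≡ false
    sym    : ∀ x y → adj x y ≡ adj y x
open Graph public

N[_]_ : ∀ {n} → Graph n → Fin n → Subset n
N[ G ] x = tabulate (λ y → does (x ≟ y) ∨ adj G x y)

-- N[X] for X ⊆ V with |X| ≤ 1, such an X being represented by Maybe (Fin n)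
-- (nothing = ∅, just x = {x}); N[∅] = ∅.
N⟦_⟧_ : ∀ {n} → Graph n → Maybe (Fin n) → Subset n
N⟦ G ⟧ nothing = ⊥
N⟦ G ⟧ just x = N[ G ] x

Identifying : ∀ {n} → Graph n → Subset n → Set
Identifying G C = ∀ X Y → X ≢ Y → (N⟦ G ⟧ X) ∩ C ≢ (N⟦ G ⟧ Y) ∩ C

InGr : (n k : ℕ) → Graph n → Set
InGr n k G = ∀ (C : Subset n) → ∣ C ∣ ≡ k → Identifying G C

GrNonempty : (n k : ℕ) → Set
GrNonempty n k = k ≤ n × Σ (Graph n) (InGr n k)

IsXi : ℕ → ℕ → Set
IsXi k m = GrNonempty m k × (∀ n → GrNonempty n k → n ≤ m)

-- A k-subset misses only n - k vertices, so every k-subset is identifying iff every closed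
-- neighbourhood has more than n - k elements and any two of them differ in more than n - k elements.
-- Put d = n + 1 - k. Counting, column by column of the neighbourhood matrix, the ordered pairs of rows that
-- differ there, and using 4c(n + 1 - c) ≤ (n + 1)², gives 2d ≤ n + 1. If n ≥ 2k - 1 this is an equality, so
-- all neighbourhoods have exactly d elements; the handshake lemma then makes d odd, while the distance
-- 2d - 2|N[x] ∩ N[y]| between two neighbourhoods is even, hence at least d + 1, and the count overshoots.
-- So n ≤ 2k - 2, and Ξ(k) exists because membership in 𝔊𝔯(n, k) is decidable and the edgeless graph on k
-- vertices is in 𝔊𝔯(k, k).
-- Conversely the 0/1 form of a symmetric Hadamard matrix of order n = 2h with positive diagonal and
-- nonnegative row sums is the neighbourhood matrix of a graph in 𝔊𝔯(n, k) for every k > h. Kronecker products of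
-- such matrices of orders 4 and 36 give all orders 4·4^a·36^b, and as 3 divides 36 but no power of 4, these
-- orders are multiplicatively dense: for large k one of them lies in [(2 - ε)k, 2k).

module Submission where

module Counting where

  open import Data.Nat hiding (_≟_)
  open import Data.Nat.Properties hiding (_≟_; suc-injective)
  open import Data.Bool using (Bool; true; false; not; _∧_; _∨_; _xor_; if_then_else_)
  open import Data.Fin using (Fin; zero; suc; _≟_; _↑ˡ_; _↑ʳ_; combine)
  open import Data.Product using (Σ; _×_; _,_)
  open import Relation.Nullary using (does)
  open import Function using (_∘_)
  open import Data.Vec.Functional using (_∷_)
  open import Data.Fin.Properties using (suc-injective)
  open import Relation.Binary.PropositionalEquality
  open import Algebra.Properties.Semiring.Sum +-*-semiring
    using (sum; sum-cong-≗; ∑-distrib-+; ∑-comm; *-distribˡ-sum)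
  open import Data.Nat.Tactic.RingSolver

  indicator : Bool → ℕ
  indicator true = 1
  indicator false = 0

  count : ∀ {n} → (Fin n → Bool) → ℕ
  count p = sum (λ i → indicator (p i))

  sum-const : ∀ n c → sum {n} (λ _ → c) ≡ n * c
  sum-const zero c = refl
  sum-const (suc n) c = cong (c +_) (sum-const n c)

  sum-mono : ∀ {n} {f g : Fin n → ℕ} → (∀ i → f i ≤ g i) → sum f ≤ sum g
  sum-mono {zero} f≤g = z≤n
  sum-mono {suc n} f≤g = +-mono-≤ (f≤g zero) (sum-mono (λ i → f≤g (suc i)))

  sum-lower : ∀ {n} (f : Fin n → ℕ) {d} → (∀ i → d ≤ f i) → n * d ≤ sum f
  sum-lower {n} f {d} d≤f = ≤-trans (≤-reflexive (sym (sum-const n d))) (sum-mono d≤f)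

  sum-lower-strict : ∀ {n} (f : Fin n → ℕ) {d} → (∀ i → d ≤ f i) → ∀ j → d < f j → n * d < sum f
  sum-lower-strict f d≤f zero d<f₀ = +-mono-<-≤ d<f₀ (sum-lower (λ i → f (suc i)) (λ i → d≤f (suc i)))
  sum-lower-strict {suc n} f d≤f (suc j) d<fⱼ =
    +-mono-≤-< (d≤f zero) (sum-lower-strict (λ i → f (suc i)) (λ i → d≤f (suc i)) j d<fⱼ)

  sum-lower-except : ∀ {n} (f : Fin n → ℕ) {d} j → (∀ i → i ≢ j → d ≤ f i) → n * d ≤ sum f + d
  sum-lower-except {suc n} f {d} zero d≤f = begin
    d + n * d                                   ≡⟨ +-comm d (n * d) ⟩
    n * d + d                                   ≤⟨ +-monoˡ-≤ d (sum-lower (λ i → f (suc i)) (λ i → d≤f (suc i) λ ())) ⟩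
    sum (λ i → f (suc i)) + d                   ≤⟨ +-monoˡ-≤ d (m≤n+m _ (f zero)) ⟩
    f zero + sum (λ i → f (suc i)) + d          ∎
    where open ≤-Reasoning
  sum-lower-except {suc n} f {d} (suc j) d≤f = begin
    d + n * d
      ≤⟨ +-mono-≤ (d≤f zero λ ()) (sum-lower-except (λ i → f (suc i)) j λ i i≢j → d≤f (suc i) (i≢j ∘ suc-injective)) ⟩
    f zero + (sum (λ i → f (suc i)) + d)        ≡⟨ +-assoc (f zero) _ d ⟨
    f zero + sum (λ i → f (suc i)) + d          ∎
    where open ≤-Reasoning

  count-cong : ∀ {n} {p q : Fin n → Bool} → (∀ i → p i ≡ q i) → count p ≡ count q
  count-cong p≗q = sum-cong-≗ (cong indicator ∘ p≗q)

  count-false : ∀ {n} (p : Fin n → Bool) → (∀ i → p i ≡ false) → count p ≡ 0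
  count-false {n} p p≗false = trans (count-cong p≗false) (trans (sum-const n 0) (*-zeroʳ n))

  count-positive : ∀ {n} (p : Fin n → Bool) x → p x ≡ true → 0 < count p
  count-positive p zero pₓ rewrite pₓ = s≤s z≤n
  count-positive p (suc x) pₓ = ≤-trans (count-positive (p ∘ suc) x pₓ) (m≤n+m _ (indicator (p zero)))

  count-complement : ∀ {n} (p : Fin n → Bool) → count p + count (not ∘ p) ≡ n
  count-complement {zero} p = refl
  count-complement {suc n} p with p zero
  ... | true = cong suc (count-complement (p ∘ suc))
  ... | false = trans (+-suc _ _) (cong suc (count-complement (p ∘ suc)))

  count-disjoint : ∀ {n} (p q : Fin n → Bool) → (∀ i → q i ≡ true → p i ≡ false) → count p + count q ≤ n
  count-disjoint {zero} p q disj = z≤n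
  count-disjoint {suc n} p q disj with p zero | q zero | disj zero
  ... | true | true | disj₀ with () ← disj₀ refl
  ... | true | false | _ = s≤s (count-disjoint (p ∘ suc) (q ∘ suc) (disj ∘ suc))
  ... | false | true | _ = ≤-trans (≤-reflexive (+-suc _ _)) (s≤s (count-disjoint (p ∘ suc) (q ∘ suc) (disj ∘ suc)))
  ... | false | false | _ = m≤n⇒m≤1+n (count-disjoint (p ∘ suc) (q ∘ suc) (disj ∘ suc))

  sub-predicate-of-size : ∀ {n} (p : Fin n → Bool) k → k ≤ count p →
    Σ (Fin n → Bool) λ q → (∀ i → q i ≡ true → p i ≡ true) × count q ≡ k
  sub-predicate-of-size {n} p zero _ = (λ _ → false) , (λ _ ()) , count-false {n} _ (λ _ → refl)
  sub-predicate-of-size {suc n} p (suc k) k<p with p zero in p₀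
  ... | true = let (q , q⊆p , ∣q∣) = sub-predicate-of-size (p ∘ suc) k (≤-pred k<p) in
    (true ∷ q) , (λ { zero _ → p₀ ; (suc i) → q⊆p i }) , cong suc ∣q∣
  ... | false = let (q , q⊆p , ∣q∣) = sub-predicate-of-size (p ∘ suc) (suc k) k<p in
    (false ∷ q) , (λ { zero () ; (suc i) → q⊆p i }) , ∣q∣

  sum-if : ∀ {n} (p : Fin n → Bool) u v →
    sum (λ i → if p i then u else v) ≡ count p * u + count (not ∘ p) * v
  sum-if {zero} p u v = refl
  sum-if {suc n} p u v with p zero
  ... | true rewrite sum-if (p ∘ suc) u v = sym (+-assoc u _ _)
  ... | false rewrite sum-if (p ∘ suc) u v = x+[y+z]≡y+[x+z] v (count (p ∘ suc) * u) (count (not ∘ p ∘ suc) * v)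
    where
    x+[y+z]≡y+[x+z] : ∀ x y z → x + (y + z) ≡ y + (x + z)
    x+[y+z]≡y+[x+z] = solve-∀

  count-xor : ∀ {n} b (p : Fin n → Bool) → count (λ i → b xor p i) ≡ (if b then count (not ∘ p) else count p)
  count-xor true p = refl
  count-xor false p = refl

  sum-count-xor : ∀ {m n} (p : Fin m → Bool) (q : Fin n → Bool) →
    sum (λ i → count (λ j → p i xor q j)) ≡ count p * count (not ∘ q) + count (not ∘ p) * count q
  sum-count-xor p q = trans (sum-cong-≗ (λ i → count-xor (p i) q)) (sum-if p _ _)

  indicator-xor-∧ : ∀ a b → indicator (a xor b) + 2 * indicator (a ∧ b) ≡ indicator a + indicator b
  indicator-xor-∧ true true = refl
  indicator-xor-∧ true false = refl
  indicator-xor-∧ false true = refl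
  indicator-xor-∧ false false = refl

  count-xor-∧ : ∀ {n} (p q : Fin n → Bool) →
    count (λ i → p i xor q i) + 2 * count (λ i → p i ∧ q i) ≡ count p + count q
  count-xor-∧ p q = begin
    count (λ i → p i xor q i) + 2 * count (λ i → p i ∧ q i)
      ≡⟨ cong (count (λ i → p i xor q i) +_) (*-distribˡ-sum 2 (λ i → indicator (p i ∧ q i))) ⟩
    count (λ i → p i xor q i) + sum (λ i → 2 * indicator (p i ∧ q i))
      ≡⟨ ∑-distrib-+ (λ i → indicator (p i xor q i)) (λ i → 2 * indicator (p i ∧ q i)) ⟨
    sum (λ i → indicator (p i xor q i) + 2 * indicator (p i ∧ q i))
      ≡⟨ sum-cong-≗ (λ i → indicator-xor-∧ (p i) (q i)) ⟩
    sum (λ i → indicator (p i) + indicator (q i))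
      ≡⟨ ∑-distrib-+ (indicator ∘ p) (indicator ∘ q) ⟩
    count p + count q ∎
    where open ≡-Reasoning

  count-insert : ∀ {n} x (p : Fin n → Bool) → p x ≡ false → count (λ z → does (x ≟ z) ∨ p z) ≡ suc (count p)
  count-insert zero p pₓ rewrite pₓ = refl
  count-insert (suc x) p pₓ = trans (cong (indicator (p zero) +_) (count-insert x (p ∘ suc) pₓ)) (+-suc _ _)

  sum-split : ∀ m n (f : Fin (m + n) → ℕ) → sum f ≡ sum (λ i → f (i ↑ˡ n)) + sum (λ j → f (m ↑ʳ j))
  sum-split zero n f = refl
  sum-split (suc m) n f rewrite sum-split m n (f ∘ suc) = sym (+-assoc (f zero) _ _)

  sum-combine : ∀ m n (f : Fin (m * n) → ℕ) → sum f ≡ sum (λ i → sum (λ j → f (combine {m} {n} i j)))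
  sum-combine zero n f = refl
  sum-combine (suc m) n f =
    trans (sum-split n (m * n) f) (cong (sum (λ j → f (j ↑ˡ (m * n))) +_) (sum-combine m n (λ r → f (n ↑ʳ r))))

module Separation where

  open import Defs hiding (sym)
  open Counting
  open import Data.Nat hiding (_≟_)
  open import Data.Nat.Properties hiding (_≟_)
  open import Data.Bool using (Bool; true; false; not; _∧_; _∨_; _xor_)
  open import Data.Bool.Properties using (∧-zeroʳ; xor-same; xor-identityʳ)
  open import Data.Fin using (Fin; _≟_)
  open import Data.Fin.Subset using (Subset; _∩_; ∣_∣)
  open import Data.Vec using (Vec; []; _∷_; lookup; tabulate)
  open import Data.Vec.Properties using (lookup∘tabulate; lookup-replicate; lookup-zipWith; tabulate∘lookup; tabulate-cong)
  open import Data.Maybe using (Maybe; just; nothing)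
  open import Data.Maybe.Properties using (just-injective)
  open import Data.Product using (Σ; _×_; _,_; proj₁; proj₂)
  open import Data.Empty using (⊥-elim)
  open import Function using (_∘_; mk⇔)
  open import Relation.Nullary using (Dec; does; yes; no)
  open import Relation.Nullary.Decidable using (dec-true; does-⇔)
  open import Relation.Binary.PropositionalEquality

  Matrix : ℕ → Set
  Matrix n = Fin n → Fin n → Bool

  distance : ∀ {n} → (Fin n → Bool) → (Fin n → Bool) → ℕ
  distance u v = count (λ z → u z xor v z)

  closedNbh : ∀ {n} → Graph n → Matrix n
  closedNbh G x z = does (x ≟ z) ∨ adj G x z

  closedNbhᴹ : ∀ {n} → Graph n → Maybe (Fin n) → Fin n → Bool
  closedNbhᴹ G nothing z = false
  closedNbhᴹ G (just x) z = closedNbh G x z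

  lookup-N⟦⟧ : ∀ {n} (G : Graph n) X z → lookup (N⟦ G ⟧ X) z ≡ closedNbhᴹ G X z
  lookup-N⟦⟧ G nothing z = lookup-replicate z false
  lookup-N⟦⟧ G (just x) z = lookup∘tabulate _ z

  ∣∣≡count : ∀ {n} (C : Subset n) → ∣ C ∣ ≡ count (lookup C)
  ∣∣≡count [] = refl
  ∣∣≡count (true ∷ C) = cong suc (∣∣≡count C)
  ∣∣≡count (false ∷ C) = ∣∣≡count C

  lookup-N⟦⟧∩ : ∀ {n} (G : Graph n) X (C : Subset n) z → lookup ((N⟦ G ⟧ X) ∩ C) z ≡ closedNbhᴹ G X z ∧ lookup C z
  lookup-N⟦⟧∩ G X C z = trans (lookup-zipWith _∧_ z (N⟦ G ⟧ X) C) (cong (_∧ lookup C z) (lookup-N⟦⟧ G X z))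

  ≗⇒≡ : ∀ {A : Set} {n} (xs ys : Vec A n) → (∀ i → lookup xs i ≡ lookup ys i) → xs ≡ ys
  ≗⇒≡ xs ys eq = trans (sym (tabulate∘lookup xs)) (trans (tabulate-cong eq) (tabulate∘lookup ys))

  ∧-cancel-true : ∀ {a b} → a ∧ true ≡ b ∧ true → a ≡ b
  ∧-cancel-true {true} {true} _ = refl
  ∧-cancel-true {false} {false} _ = refl

  not-xor⇒≡ : ∀ a b → not (a xor b) ≡ true → a ≡ b
  not-xor⇒≡ true true _ = refl
  not-xor⇒≡ false false _ = refl

  same-trace⇒agree : ∀ {n} (G : Graph n) (C : Subset n) X Y → (N⟦ G ⟧ X) ∩ C ≡ (N⟦ G ⟧ Y) ∩ C →
    ∀ z → lookup C z ≡ true → (closedNbhᴹ G X z xor closedNbhᴹ G Y z) ≡ false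
  same-trace⇒agree G C X Y eq z C∋z with lookup-N⟦⟧∩ G X C z | lookup-N⟦⟧∩ G Y C z | cong (λ v → lookup v z) eq
  ... | eqX | eqY | eqXY rewrite C∋z =
    trans (cong (_xor closedNbhᴹ G Y z) (∧-cancel-true (trans (sym eqX) (trans eqXY eqY)))) (xor-same (closedNbhᴹ G Y z))

  -- C misses only n - |C| points, so it separates X and Y as soon as their neighbourhoods differ in more of them.
  far⇒separated : ∀ {n k} (G : Graph n) (C : Subset n) → ∣ C ∣ ≡ k → ∀ X Y →
    n < distance (closedNbhᴹ G X) (closedNbhᴹ G Y) + k → (N⟦ G ⟧ X) ∩ C ≢ (N⟦ G ⟧ Y) ∩ C
  far⇒separated G C ∣C∣≡k X Y far eq = <⇒≱ far (subst (λ c → _ + c ≤ _) (trans (sym (∣∣≡count C)) ∣C∣≡k)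
    (count-disjoint (λ z → closedNbhᴹ G X z xor closedNbhᴹ G Y z) (lookup C) (same-trace⇒agree G C X Y eq)))

  far⇒InGr : ∀ {n k} (G : Graph n) → (∀ X Y → X ≢ Y → n < distance (closedNbhᴹ G X) (closedNbhᴹ G Y) + k) →
    InGr n k G
  far⇒InGr G far C ∣C∣≡k X Y X≢Y = far⇒separated G C ∣C∣≡k X Y (far X Y X≢Y)

  InGr⇒far : ∀ {n k} (G : Graph n) → k ≤ n → InGr n k G →
    ∀ X Y → X ≢ Y → n < distance (closedNbhᴹ G X) (closedNbhᴹ G Y) + k
  InGr⇒far {n} {k} G k≤n inGr X Y X≢Y with n <? distance (closedNbhᴹ G X) (closedNbhᴹ G Y) + k
  ... | yes far = far
  ... | no ¬far = ⊥-elim (inGr C ∣C∣≡k X Y X≢Y agree)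
    where
    differ = λ z → closedNbhᴹ G X z xor closedNbhᴹ G Y z
    k≤agree : k ≤ count (not ∘ differ)
    k≤agree = +-cancelˡ-≤ (count differ) k _ (≤-trans (≮⇒≥ ¬far) (≤-reflexive (sym (count-complement differ))))
    chosen = sub-predicate-of-size (not ∘ differ) k k≤agree
    c = proj₁ chosen
    C : Subset n
    C = tabulate c
    ∣C∣≡k : ∣ C ∣ ≡ k
    ∣C∣≡k = trans (∣∣≡count C) (trans (count-cong (lookup∘tabulate c)) (proj₂ (proj₂ chosen)))
    agree-on-c : ∀ z → closedNbhᴹ G X z ∧ c z ≡ closedNbhᴹ G Y z ∧ c z
    agree-on-c z with c z in c∋z
    ... | true = cong (_∧ true) (not-xor⇒≡ _ _ (proj₁ (proj₂ chosen) z c∋z))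
    ... | false = trans (∧-zeroʳ _) (sym (∧-zeroʳ _))
    agree : (N⟦ G ⟧ X) ∩ C ≡ (N⟦ G ⟧ Y) ∩ C
    agree = ≗⇒≡ _ _ λ z → begin
      lookup ((N⟦ G ⟧ X) ∩ C) z           ≡⟨ lookup-N⟦⟧∩ G X C z ⟩
      closedNbhᴹ G X z ∧ lookup C z       ≡⟨ cong (closedNbhᴹ G X z ∧_) (lookup∘tabulate c z) ⟩
      closedNbhᴹ G X z ∧ c z              ≡⟨ agree-on-c z ⟩
      closedNbhᴹ G Y z ∧ c z              ≡⟨ cong (closedNbhᴹ G Y z ∧_) (lookup∘tabulate c z) ⟨
      closedNbhᴹ G Y z ∧ lookup C z       ≡⟨ lookup-N⟦⟧∩ G Y C z ⟨
      lookup ((N⟦ G ⟧ Y) ∩ C) z           ∎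
      where open ≡-Reasoning

  Separating : ∀ {n} → ℕ → Matrix n → Set
  Separating {n} k M = (∀ x → n < count (M x) + k) × (∀ x y → x ≢ y → n < distance (M x) (M y) + k)

  Separating-cong : ∀ {n k} {M M′ : Matrix n} → (∀ x z → M x z ≡ M′ x z) → Separating k M → Separating k M′
  Separating-cong {k = k} M≗M′ (heavy , far) =
    (λ x → subst (λ c → _ < c + k) (count-cong (M≗M′ x)) (heavy x)) ,
    (λ x y x≢y → subst (λ c → _ < c + k) (count-cong (λ z → cong₂ _xor_ (M≗M′ x z) (M≗M′ y z))) (far x y x≢y))

  separating⇒far : ∀ {n k} (G : Graph n) → Separating k (closedNbh G) →
    ∀ X Y → X ≢ Y → n < distance (closedNbhᴹ G X) (closedNbhᴹ G Y) + k
  separating⇒far G sep nothing nothing X≢Y = ⊥-elim (X≢Y refl)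
  separating⇒far G (heavy , far) nothing (just y) _ = heavy y
  separating⇒far {k = k} G (heavy , far) (just x) nothing _ =
    subst (λ c → _ < c + k) (count-cong (λ z → sym (xor-identityʳ (closedNbh G x z)))) (heavy x)
  separating⇒far G (heavy , far) (just x) (just y) X≢Y = far x y (X≢Y ∘ cong just)

  separating⇒InGr : ∀ {n k} (G : Graph n) → Separating k (closedNbh G) → InGr n k G
  separating⇒InGr G sep = far⇒InGr G (separating⇒far G sep)

  InGr⇒separating : ∀ {n k} (G : Graph n) → k ≤ n → InGr n k G → Separating k (closedNbh G)
  InGr⇒separating G k≤n inGr =
    (λ x → InGr⇒far G k≤n inGr nothing (just x) λ ()) ,
    (λ x y x≢y → InGr⇒far G k≤n inGr (just x) (just y) (x≢y ∘ just-injective))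

  SymmetricMatrix : ∀ {n} → Matrix n → Set
  SymmetricMatrix M = ∀ x y → M x y ≡ M y x

  ReflexiveMatrix : ∀ {n} → Matrix n → Set
  ReflexiveMatrix M = ∀ x → M x x ≡ true

  ≟-refl : ∀ {n} (x : Fin n) → does (x ≟ x) ≡ true
  ≟-refl x = dec-true (x ≟ x) refl

  ≟-sym : ∀ {n} (x y : Fin n) → does (x ≟ y) ≡ does (y ≟ x)
  ≟-sym x y = does-⇔ (mk⇔ sym sym) (x ≟ y) (y ≟ x)

  closedNbh-symmetric : ∀ {n} (G : Graph n) → SymmetricMatrix (closedNbh G)
  closedNbh-symmetric G x y = cong₂ _∨_ (≟-sym x y) (Graph.sym G x y)

  closedNbh-reflexive : ∀ {n} (G : Graph n) → ReflexiveMatrix (closedNbh G)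
  closedNbh-reflexive G x = cong (_∨ adj G x x) (≟-refl x)

  graphOf : ∀ {n} (M : Matrix n) → SymmetricMatrix M → Graph n
  graphOf M M-sym = record
    { adj = λ x y → not (does (x ≟ y)) ∧ M x y
    ; irrefl = λ x → cong (λ b → not b ∧ M x x) (≟-refl x)
    ; sym = λ x y → cong₂ (λ b c → not b ∧ c) (≟-sym x y) (M-sym x y)
    }

  closedNbh-graphOf : ∀ {n} (M : Matrix n) (M-sym : SymmetricMatrix M) → ReflexiveMatrix M →
    ∀ x z → closedNbh (graphOf M M-sym) x z ≡ M x z
  closedNbh-graphOf M M-sym M-refl x z with x ≟ z
  ... | yes refl = sym (M-refl x)
  ... | no _ = refl

  separating⇒Gr : ∀ {n k} (M : Matrix n) → SymmetricMatrix M → ReflexiveMatrix M → Separating k M →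
    Σ (Graph n) (InGr n k)
  separating⇒Gr M M-sym M-refl sep =
    graphOf M M-sym , separating⇒InGr _ (Separating-cong (λ x z → sym (closedNbh-graphOf M M-sym M-refl x z)) sep)

  edgeless : ∀ {n} → Graph n
  edgeless = record { adj = λ _ _ → false ; irrefl = λ _ → refl ; sym = λ _ _ → refl }

  edgeless-InGr : ∀ n → InGr n n edgeless
  edgeless-InGr n = separating⇒InGr edgeless (heavy , far)
    where
    n<c+n : ∀ {c} → 0 < c → n < c + n
    n<c+n 0<c = +-monoˡ-≤ n 0<c
    heavy : ∀ x → n < count (closedNbh edgeless x) + n
    heavy x = n<c+n (count-positive _ x (closedNbh-reflexive edgeless x))
    far : ∀ x y → x ≢ y → n < distance (closedNbh edgeless x) (closedNbh edgeless y) + n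
    far x y x≢y = n<c+n (count-positive _ x (differs (x ≟ x) (y ≟ x)))
      where
      differs : (x? : Dec (x ≡ x)) (y? : Dec (y ≡ x)) → (does x? ∨ false) xor (does y? ∨ false) ≡ true
      differs (yes _) (no _) = refl
      differs (no x≢x) _ = ⊥-elim (x≢x refl)
      differs (yes _) (yes y≡x) = ⊥-elim (x≢y (sym y≡x))

module OrderBound where

  open import Defs hiding (sym)
  open Counting
  open Separation
  open import Data.Nat hiding (_≟_)
  open import Data.Nat.Properties hiding (_≟_)
  open import Data.Nat.Divisibility using (_∣_; divides; m∣m*n; ∣m+n∣m⇒∣n; ∣1⇒≡1)
  open import Data.Bool using (Bool; false; not; _∧_; _xor_)
  open import Data.Fin using (Fin; zero; suc)
  open import Data.Fin.Properties using (any?)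
  open import Data.Product using (Σ; _×_; _,_; proj₁; proj₂)
  open import Data.Sum using (inj₁; inj₂)
  open import Data.Empty using (⊥; ⊥-elim)
  open import Function using (_∘_)
  open import Relation.Nullary using (¬_; yes; no)
  open import Relation.Binary.PropositionalEquality
  open import Algebra.Properties.Semiring.Sum +-*-semiring using (sum; sum-cong-≗; ∑-distrib-+; ∑-comm; *-distribˡ-sum)
  open import Data.Nat.Tactic.RingSolver

  am-gm-≤ : ∀ {a b} → a ≤ b → 4 * (a * b) ≤ (a + b) * (a + b)
  am-gm-≤ {a} a≤b with m≤n⇒∃[o]m+o≡n a≤b
  ... | t , refl = ≤-trans (m≤m+n _ (t * t)) (≤-reflexive (square-of-sum a t))
    where
    square-of-sum : ∀ a t → 4 * (a * (a + t)) + t * t ≡ (a + (a + t)) * (a + (a + t))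
    square-of-sum = solve-∀

  am-gm : ∀ a b → 4 * (a * b) ≤ (a + b) * (a + b)
  am-gm a b with ≤-total a b
  ... | inj₁ a≤b = am-gm-≤ a≤b
  ... | inj₂ b≤a = subst₂ _≤_ (cong (4 *_) (*-comm b a)) (cong₂ _*_ (+-comm b a) (+-comm b a)) (am-gm-≤ b≤a)

  -- Double counting gives 2(D + 2W) ≤ n(n + 1)² for the sum D of the distances between ordered pairs of rows and
  -- the total weight W; with D ≥ n(n - 1)e and W ≥ w this becomes the following, stated without subtraction.
  CountingBound : ℕ → ℕ → ℕ → Set
  CountingBound n e w = 2 * (n * (n * e) + 2 * w) ≤ n * (suc n * suc n) + 2 * (n * e)

  module _ {n : ℕ} (M : Matrix n) where

    pairDistanceSum : ℕ
    pairDistanceSum = sum λ x → sum λ y → distance (M x) (M y)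

    weightSum : ℕ
    weightSum = sum λ x → count (M x)

    column : Fin n → Fin n → Bool
    column z x = M x z

    pairDistanceSum-by-columns :
      pairDistanceSum ≡ sum λ z → count (column z) * count (not ∘ column z) + count (not ∘ column z) * count (column z)
    pairDistanceSum-by-columns = begin
      pairDistanceSum
        ≡⟨ sum-cong-≗ (λ x → ∑-comm λ y z → indicator (M x z xor M y z)) ⟩
      (sum λ x → sum λ z → sum λ y → indicator (M x z xor M y z))
        ≡⟨ ∑-comm (λ x z → sum λ y → indicator (M x z xor M y z)) ⟩
      (sum λ z → sum λ x → count λ y → M x z xor M y z)
        ≡⟨ sum-cong-≗ (λ z → sum-count-xor (column z) (column z)) ⟩
      (sum λ z → count (column z) * count (not ∘ column z) + count (not ∘ column z) * count (column z)) ∎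
      where open ≡-Reasoning

    weightSum-by-columns : weightSum ≡ sum λ z → count (column z)
    weightSum-by-columns = ∑-comm λ x z → indicator (M x z)

    -- A column with c ones contributes 2c(n - c) ordered pairs of rows differing there, and c to the weight.
    column-bound : ∀ z → 2 * (count (column z) * count (not ∘ column z) + count (not ∘ column z) * count (column z)
                          + 2 * count (column z)) ≤ suc n * suc n
    column-bound z = subst₂ _≤_ (regroup c c′) (cong (λ m → m * m) c+c′+1≡1+n) (am-gm c (c′ + 1))
      where
      c = count (column z)
      c′ = count (not ∘ column z)
      regroup : ∀ c c′ → 4 * (c * (c′ + 1)) ≡ 2 * (c * c′ + c′ * c + 2 * c)
      regroup = solve-∀
      c+c′+1≡1+n : c + (c′ + 1) ≡ suc n
      c+c′+1≡1+n = trans (sym (+-assoc c c′ 1)) (trans (cong (_+ 1) (count-complement (column z))) (+-comm n 1))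

    double-count-bound : 2 * (pairDistanceSum + 2 * weightSum) ≤ n * (suc n * suc n)
    double-count-bound = begin
      2 * (pairDistanceSum + 2 * weightSum)
        ≡⟨ cong₂ (λ p w → 2 * (p + 2 * w)) pairDistanceSum-by-columns weightSum-by-columns ⟩
      2 * (sum f + 2 * sum (count ∘ column))
        ≡⟨ cong (λ w → 2 * (sum f + w)) (*-distribˡ-sum 2 (count ∘ column)) ⟩
      2 * (sum f + sum (λ z → 2 * count (column z)))
        ≡⟨ cong (2 *_) (∑-distrib-+ f (λ z → 2 * count (column z))) ⟨
      2 * sum (λ z → f z + 2 * count (column z))
        ≡⟨ *-distribˡ-sum 2 (λ z → f z + 2 * count (column z)) ⟩
      sum (λ z → 2 * (f z + 2 * count (column z)))
        ≤⟨ sum-mono column-bound ⟩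
      sum {n} (λ _ → suc n * suc n)
        ≡⟨ sum-const n (suc n * suc n) ⟩
      n * (suc n * suc n) ∎
      where
      open ≤-Reasoning
      f = λ z → count (column z) * count (not ∘ column z) + count (not ∘ column z) * count (column z)

    pairDistanceSum-lower : ∀ {e} → (∀ x y → x ≢ y → e ≤ distance (M x) (M y)) → n * (n * e) ≤ pairDistanceSum + n * e
    pairDistanceSum-lower {e} far = begin
      n * (n * e)                        ≡⟨ sum-const n (n * e) ⟨
      sum {n} (λ _ → n * e)              ≤⟨ sum-mono (λ x → sum-lower-except (rowSum x) x λ y y≢x → far x y (y≢x ∘ sym)) ⟩
      sum (λ x → sum (rowSum x) + e)     ≡⟨ ∑-distrib-+ (λ x → sum (rowSum x)) (λ _ → e) ⟩
      pairDistanceSum + sum {n} (λ _ → e) ≡⟨ cong (pairDistanceSum +_) (sum-const n e) ⟩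
      pairDistanceSum + n * e            ∎
      where
      open ≤-Reasoning
      rowSum = λ x y → distance (M x) (M y)

    counting-inequality : ∀ {e w} → (∀ x y → x ≢ y → e ≤ distance (M x) (M y)) → w ≤ weightSum →
      CountingBound n e w
    counting-inequality {e} {w} far w≤W = begin
      2 * (n * (n * e) + 2 * w)
        ≤⟨ *-monoʳ-≤ 2 (+-mono-≤ (pairDistanceSum-lower far) (*-monoʳ-≤ 2 w≤W)) ⟩
      2 * (pairDistanceSum + n * e + 2 * weightSum)
        ≡⟨ regroup pairDistanceSum (n * e) weightSum ⟩
      2 * (pairDistanceSum + 2 * weightSum) + 2 * (n * e)
        ≤⟨ +-monoˡ-≤ (2 * (n * e)) double-count-bound ⟩
      n * (suc n * suc n) + 2 * (n * e) ∎
      where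
      open ≤-Reasoning
      regroup : ∀ p q w → 2 * (p + q + 2 * w) ≡ 2 * (p + 2 * w) + 2 * q
      regroup = solve-∀

  degree-sum-even : ∀ {n} (a : Matrix n) → SymmetricMatrix a → (∀ x → a x x ≡ false) → 2 ∣ sum (λ x → count (a x))
  degree-sum-even {zero} a a-sym a-irrefl = divides 0 refl
  degree-sum-even {suc n} a a-sym a-irrefl
    with degree-sum-even (λ x y → a (suc x) (suc y)) (λ x y → a-sym (suc x) (suc y)) (a-irrefl ∘ suc)
  ... | divides q rest≡q*2 = divides (r + q) (begin
    indicator (a zero zero) + r + sum (λ x → first x + rest x) ≡⟨ cong (λ b → indicator b + r + sum (λ x → first x + rest x)) (a-irrefl zero) ⟩
    r + sum (λ x → first x + rest x)                          ≡⟨ cong (r +_) (∑-distrib-+ first rest) ⟩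
    r + (sum first + sum rest)                                ≡⟨ cong₂ (λ c s → r + (c + s)) first≡r rest≡q*2 ⟩
    r + (r + q * 2)                                           ≡⟨ regroup r q ⟩
    (r + q) * 2                                               ∎)
    where
    open ≡-Reasoning
    r = count (λ y → a zero (suc y))
    first = λ x → indicator (a (suc x) zero)
    rest = λ x → count (λ y → a (suc x) (suc y))
    first≡r : sum first ≡ r
    first≡r = count-cong (λ x → a-sym (suc x) zero)
    regroup : ∀ r q → r + (r + q * 2) ≡ (r + q) * 2
    regroup = solve-∀

  weightSum-closedNbh : ∀ {n} (G : Graph n) → weightSum (closedNbh G) ≡ n + sum (λ x → count (adj G x))
  weightSum-closedNbh {n} G = begin
    weightSum (closedNbh G)                         ≡⟨ sum-cong-≗ (λ x → count-insert x (adj G x) (irrefl G x)) ⟩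
    sum (λ x → 1 + count (adj G x))                 ≡⟨ ∑-distrib-+ (λ _ → 1) (λ x → count (adj G x)) ⟩
    sum {n} (λ _ → 1) + degrees                     ≡⟨ cong (_+ degrees) (trans (sum-const n 1) (*-identityʳ n)) ⟩
    n + degrees                                     ∎
    where
    open ≡-Reasoning
    degrees = sum (λ x → count (adj G x))

  ≰-by-excess : ∀ {a b c} → a ≡ b + c → 0 < c → ¬ a ≤ b
  ≰-by-excess {b = b} {c} refl 0<c a≤b = <⇒≱ 0<c (+-cancelˡ-≤ b c 0 (≤-trans a≤b (≤-reflexive (sym (+-identityʳ b)))))

  weight-excess-impossible : ∀ {n} t → n ≡ 2 * t + 1 → ¬ CountingBound n (t + 1) (suc (n * (t + 1)))
  weight-excess-impossible t n≡2t+1 =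
    subst (λ n → ¬ CountingBound n (t + 1) (suc (n * (t + 1)))) (sym n≡2t+1) (≰-by-excess (exceeds-by-4 t) (s≤s z≤n))
    where
    exceeds-by-4 : ∀ t →
      2 * ((2 * t + 1) * ((2 * t + 1) * (t + 1)) + 2 * suc ((2 * t + 1) * (t + 1)))
      ≡ (2 * t + 1) * (suc (2 * t + 1) * suc (2 * t + 1)) + 2 * ((2 * t + 1) * (t + 1)) + 4
    exceeds-by-4 = solve-∀

  distance-excess-impossible : ∀ {n} t → n ≡ 2 * t + 1 → 1 ≤ t → ¬ CountingBound n (suc (t + 1)) (n * (t + 1))
  distance-excess-impossible t n≡2t+1 1≤t =
    subst (λ n → ¬ CountingBound n (suc (t + 1)) (n * (t + 1))) (sym n≡2t+1)
      (≰-by-excess (exceeds t) (*-mono-≤ {1} {4} (s≤s z≤n) (*-mono-≤ 1≤t (m≤n+m 1 (2 * t)))))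
    where
    exceeds : ∀ t →
      2 * ((2 * t + 1) * ((2 * t + 1) * suc (t + 1)) + 2 * ((2 * t + 1) * (t + 1)))
      ≡ (2 * t + 1) * (suc (2 * t + 1) * suc (2 * t + 1)) + 2 * ((2 * t + 1) * suc (t + 1)) + 4 * (t * (2 * t + 1))
    exceeds = solve-∀

  odd-degree-sum-parity : ∀ {n} t q → n ≡ 2 * t + 1 → n * (t + 1) ≡ n + q * 2 → 2 ∣ t
  odd-degree-sum-parity t q n≡2t+1 eq = ∣m+n∣m⇒∣n (divides q (+-cancelˡ-≡ (2 * t + 1) _ _
    (trans (sym (expand t)) (subst (λ n → n * (t + 1) ≡ n + q * 2) n≡2t+1 eq)))) (m∣m*n (t * t))
    where
    expand : ∀ t → (2 * t + 1) * (t + 1) ≡ (2 * t + 1) + (2 * (t * t) + t)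
    expand = solve-∀

  2∤1 : ¬ 2 ∣ 1
  2∤1 2∣1 with ∣1⇒≡1 2∣1
  ... | ()


  no-odd-separated-graph : ∀ {n} t (G : Graph n) → n ≡ 2 * t + 1 → 1 ≤ t →
    (∀ x → t + 1 ≤ count (closedNbh G x)) → (∀ x y → x ≢ y → t + 1 ≤ distance (closedNbh G x) (closedNbh G y)) → ⊥
  no-odd-separated-graph {n} t G n≡2t+1 1≤t heavy far with any? (λ x → t + 1 <? count (closedNbh G x))
  ... | yes (x , excess) =
    weight-excess-impossible t n≡2t+1 (counting-inequality (closedNbh G) far (sum-lower-strict _ heavy x excess))
  ... | no ¬excess =
    distance-excess-impossible t n≡2t+1 1≤t (counting-inequality M farther (sum-lower _ heavy))
    where
    M = closedNbh G
    regular : ∀ x → count (M x) ≡ t + 1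
    regular x = ≤-antisym (≮⇒≥ (λ excess → ¬excess (x , excess))) (heavy x)
    2∣t : 2 ∣ t
    2∣t with degree-sum-even (adj G) (Graph.sym G) (irrefl G)
    ... | divides q deg≡q*2 = odd-degree-sum-parity t q n≡2t+1 (begin
      n * (t + 1)                         ≡⟨ sum-const n (t + 1) ⟨
      sum {n} (λ _ → t + 1)               ≡⟨ sum-cong-≗ regular ⟨
      weightSum M                         ≡⟨ weightSum-closedNbh G ⟩
      n + sum (λ x → count (adj G x))     ≡⟨ cong (n +_) deg≡q*2 ⟩
      n + q * 2                           ∎)
      where open ≡-Reasoning
    -- Two rows of odd weight t + 1 sharing i ones are at the even distance 2(t + 1 - i).
    farther : ∀ x y → x ≢ y → suc (t + 1) ≤ distance (M x) (M y)
    farther x y x≢y = ≤∧≢⇒< (far x y x≢y) λ d≡dist → 2∤1 (∣m+n∣m⇒∣n (2∣1+t d≡dist) 2∣t)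
      where
      shared = count (λ z → M x z ∧ M y z)
      2∣1+t : t + 1 ≡ distance (M x) (M y) → 2 ∣ t + 1
      2∣1+t d≡dist = divides shared (+-cancelˡ-≡ (t + 1) _ _ (begin
        (t + 1) + (t + 1)                                 ≡⟨ cong₂ _+_ (regular x) (regular y) ⟨
        count (M x) + count (M y)                         ≡⟨ count-xor-∧ (M x) (M y) ⟨
        distance (M x) (M y) + 2 * shared                 ≡⟨ cong₂ _+_ d≡dist (*-comm shared 2) ⟨
        (t + 1) + shared * 2                              ∎))
        where open ≡-Reasoning

  counting-bound⇒2d≤1+n : ∀ {n d} → 0 < n → CountingBound n d (n * d) → d + d ≤ suc n
  counting-bound⇒2d≤1+n {n} {d} 0<n bound = *-cancelʳ-≤ (d + d) (suc n) (n * suc n) {{n*[1+n]≢0}}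
    (+-cancelʳ-≤ (2 * (n * d)) _ _ (subst₂ _≤_ (lhs n d) (rhs n d) bound))
    where
    n*[1+n]≢0 : NonZero (n * suc n)
    n*[1+n]≢0 = m*n≢0 n (suc n) {{>-nonZero 0<n}}
    lhs : ∀ n d → 2 * (n * (n * d) + 2 * (n * d)) ≡ (d + d) * (n * suc n) + 2 * (n * d)
    lhs = solve-∀
    rhs : ∀ n d → n * (suc n * suc n) + 2 * (n * d) ≡ suc n * (n * suc n) + 2 * (n * d)
    rhs = solve-∀

  odd-halves : ∀ {n d} → d + d ≡ suc n → Σ ℕ λ t → n ≡ 2 * t + 1 × d ≡ t + 1
  odd-halves {d = suc t} 2d≡1+n = t , trans (sym (suc-injective 2d≡1+n)) (t+[1+t]≡2t+1 t) , +-comm 1 t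
    where
    t+[1+t]≡2t+1 : ∀ t → t + suc t ≡ 2 * t + 1
    t+[1+t]≡2t+1 = solve-∀

  half-positive : ∀ {n} t → n ≡ 2 * t + 1 → 2 ≤ n → 1 ≤ t
  half-positive zero refl (s≤s ())
  half-positive (suc t) _ _ = s≤s z≤n

  InGr⇒order-bound : ∀ {n k} (G : Graph n) → 2 ≤ k → k ≤ n → InGr n k G → n + 2 ≤ 2 * k
  InGr⇒order-bound {n} {k} G 2≤k k≤n inGr with n + 2 ≤? 2 * k
  ... | yes bound = bound
  ... | no ¬bound = ⊥-elim (no-odd-separated-graph t G n≡2t+1 (half-positive t n≡2t+1 (≤-trans 2≤k k≤n))
                     (λ x → subst (_≤ count (closedNbh G x)) d≡t+1 (heavy x))
                     (λ x y x≢y → subst (_≤ distance (closedNbh G x) (closedNbh G y)) d≡t+1 (far x y x≢y)))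
    where
    d = suc n ∸ k
    d+k≡1+n : d + k ≡ suc n
    d+k≡1+n = m∸n+n≡m (m≤n⇒m≤1+n k≤n)
    separating = InGr⇒separating G k≤n inGr
    at-least-d : ∀ {c} → n < c + k → d ≤ c
    at-least-d {c} n<c+k = +-cancelʳ-≤ k d c (subst (_≤ c + k) (sym d+k≡1+n) n<c+k)
    heavy : ∀ x → d ≤ count (closedNbh G x)
    heavy x = at-least-d (proj₁ separating x)
    far : ∀ x y → x ≢ y → d ≤ distance (closedNbh G x) (closedNbh G y)
    far x y x≢y = at-least-d (proj₂ separating x y x≢y)
    2d≤1+n : d + d ≤ suc n
    2d≤1+n = counting-bound⇒2d≤1+n (≤-trans (s≤s z≤n) (≤-trans 2≤k k≤n))
               (counting-inequality (closedNbh G) far (sum-lower _ heavy))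
    2k≤1+n : k + k ≤ suc n
    2k≤1+n = subst (_≤ suc n) (cong (k +_) (+-identityʳ k)) (≤-pred (subst (2 * k <_) (+-comm n 2) (≰⇒> ¬bound)))
    1+n≤2d : suc n ≤ d + d
    1+n≤2d = +-cancelʳ-≤ (k + k) (suc n) (d + d) (begin
      suc n + (k + k)      ≤⟨ +-monoʳ-≤ (suc n) 2k≤1+n ⟩
      suc n + suc n        ≡⟨ cong₂ _+_ d+k≡1+n d+k≡1+n ⟨
      d + k + (d + k)      ≡⟨ regroup d k ⟩
      d + d + (k + k)      ∎)
      where
      open ≤-Reasoning
      regroup : ∀ d k → d + k + (d + k) ≡ d + d + (k + k)
      regroup = solve-∀
    halves = odd-halves (≤-antisym 2d≤1+n 1+n≤2d)
    t = proj₁ halves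
    n≡2t+1 = proj₁ (proj₂ halves)
    d≡t+1 = proj₂ (proj₂ halves)

module Existence where

  open import Defs hiding (sym)
  open Counting
  open Separation
  open OrderBound
  open import Data.Nat hiding (_≟_)
  open import Data.Nat.Properties hiding (_≟_)
  open import Data.Bool using (true)
  open import Data.Bool.Properties using () renaming (_≟_ to _≟ᴮ_)
  open import Data.Fin using (_≟_)
  open import Data.Fin.Properties using (all?)
  open import Data.Fin.Subset using (Subset)
  open import Data.Fin.Subset.Properties using (anySubset?)
  open import Data.Vec using (Vec; []; _∷_; lookup; tabulate)
  open import Data.Vec.Properties using (lookup∘tabulate)
  open import Data.Product using (Σ; _×_; _,_; proj₁; proj₂; ∃)
  open import Data.Empty using (⊥-elim)
  open import Relation.Nullary using (Dec; yes; no)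
  open import Relation.Nullary.Decidable using (map′; _×-dec_; _→-dec_; ¬?)
  open import Relation.Unary using (Decidable)
  open import Relation.Binary.PropositionalEquality

  anyVec? : ∀ {m n} {P : Vec (Subset n) m → Set} → Decidable P → Dec (∃ P)
  anyVec? {zero} P? = map′ ([] ,_) (λ { ([] , p) → p }) (P? [])
  anyVec? {suc m} P? = map′ (λ (r , T , p) → r ∷ T , p) (λ { (r ∷ T , p) → r , T , p })
    (anySubset? λ r → anyVec? λ T → P? (r ∷ T))

  toMatrix : ∀ {n} → Vec (Subset n) n → Matrix n
  toMatrix T x y = lookup (lookup T x) y

  fromMatrix : ∀ {n} → Matrix n → Vec (Subset n) n
  fromMatrix M = tabulate λ x → tabulate (M x)

  toMatrix∘fromMatrix : ∀ {n} (M : Matrix n) x y → toMatrix (fromMatrix M) x y ≡ M x y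
  toMatrix∘fromMatrix M x y = trans (cong (λ r → lookup r y) (lookup∘tabulate _ x)) (lookup∘tabulate (M x) y)

  NeighbourhoodMatrix : ∀ {n} → ℕ → Matrix n → Set
  NeighbourhoodMatrix k M = SymmetricMatrix M × ReflexiveMatrix M × Separating k M

  neighbourhoodMatrix? : ∀ {n} k (M : Matrix n) → Dec (NeighbourhoodMatrix k M)
  neighbourhoodMatrix? {n} k M =
    all? (λ x → all? λ y → M x y ≟ᴮ M y x) ×-dec
    all? (λ x → M x x ≟ᴮ true) ×-dec
    all? (λ x → n <? count (M x) + k) ×-dec
    all? (λ x → all? λ y → ¬? (x ≟ y) →-dec (n <? distance (M x) (M y) + k))

  Gr? : ∀ n k → k ≤ n → Dec (Σ (Graph n) (InGr n k))
  Gr? n k k≤n = map′ realise neighbourhoods (anyVec? λ T → neighbourhoodMatrix? k (toMatrix T))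
    where
    realise : (∃ λ T → NeighbourhoodMatrix k (toMatrix T)) → Σ (Graph n) (InGr n k)
    realise (T , M-sym , M-refl , sep) = separating⇒Gr (toMatrix T) M-sym M-refl sep
    neighbourhoods : Σ (Graph n) (InGr n k) → (∃ λ T → NeighbourhoodMatrix k (toMatrix T))
    neighbourhoods (G , inGr) = fromMatrix (closedNbh G) ,
      (λ x y → trans (≡T x y) (trans (closedNbh-symmetric G x y) (sym (≡T y x)))) ,
      (λ x → trans (≡T x x) (closedNbh-reflexive G x)) ,
      Separating-cong (λ x y → sym (≡T x y)) (InGr⇒separating G k≤n inGr)
      where ≡T = toMatrix∘fromMatrix (closedNbh G)

  GrNonempty? : ∀ n k → Dec (GrNonempty n k)
  GrNonempty? n k with k ≤? n
  ... | no k≰n = no λ nonempty → k≰n (proj₁ nonempty)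
  ... | yes k≤n = map′ (k≤n ,_) proj₂ (Gr? n k k≤n)

  maximum-below : ∀ {P : ℕ → Set} → Decidable P → ∀ B {a} → P a → (∀ n → P n → n ≤ B) →
    Σ ℕ λ m → P m × (∀ n → P n → n ≤ m)
  maximum-below P? B Pa bounded with P? B
  ... | yes PB = B , PB , bounded
  maximum-below {P} P? zero Pa bounded | no ¬P0 = ⊥-elim (¬P0 (subst P (n≤0⇒n≡0 (bounded _ Pa)) Pa))
  maximum-below {P} P? (suc B) Pa bounded | no ¬P1+B =
    maximum-below P? B Pa λ n Pn → m<1+n⇒m≤n (≤∧≢⇒< (bounded n Pn) λ n≡1+B → ¬P1+B (subst P n≡1+B Pn))

  GrNonempty-order-bound : ∀ {n k} → 2 ≤ k → GrNonempty n k → n + 2 ≤ 2 * k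
  GrNonempty-order-bound 2≤k (k≤n , G , inGr) = InGr⇒order-bound G 2≤k k≤n inGr

  GrNonempty⇒≤2k∸2 : ∀ {n k} → 2 ≤ k → GrNonempty n k → n ≤ 2 * k ∸ 2
  GrNonempty⇒≤2k∸2 {n} {k} 2≤k nonempty =
    subst (_≤ 2 * k ∸ 2) (m+n∸n≡m n 2) (∸-monoˡ-≤ 2 (GrNonempty-order-bound 2≤k nonempty))

  Ξ-exists : ∀ k → 2 ≤ k → Σ ℕ λ m → IsXi k m × m ≤ 2 * k ∸ 2
  Ξ-exists k 2≤k with maximum-below (λ n → GrNonempty? n k) (2 * k ∸ 2) (≤-refl , edgeless , edgeless-InGr k)
                                    (λ n → GrNonempty⇒≤2k∸2 2≤k)
  ... | m , nonempty , maximal = m , (nonempty , maximal) , GrNonempty⇒≤2k∸2 2≤k nonempty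

module HadamardMatrices where

  open import Defs hiding (sym)
  open Counting
  open Separation
  open import Data.Nat renaming (_≟_ to _≟ℕ_)
  open import Data.Nat.Properties hiding (_≟_)
  open import Data.Bool using (Bool; true; false; not; _∧_; _∨_; _xor_)
  open import Data.Bool.Properties using (not-involutive; not-distribʳ-xor; xor-same) renaming (_≟_ to _≟ᴮ_)
  open import Data.Fin using (Fin; zero; suc; _≟_; combine; remQuot; toℕ)
  open import Data.Fin.Properties using (remQuot-combine; combine-remQuot; all?)
  open import Data.Product using (Σ; _×_; _,_; proj₁; proj₂)
  open import Data.Empty using (⊥-elim)
  open import Function using (_∘_)
  open import Relation.Nullary using (¬_; Dec; yes; no)
  open import Relation.Nullary.Decidable using (True; toWitness; _×-dec_; _→-dec_; ¬?)
  open import Data.Vec using (Vec; []; _∷_; lookup)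
  open import Relation.Binary.PropositionalEquality
  open import Algebra.Properties.Semiring.Sum +-*-semiring using (sum; sum-cong-≗)
  open import Data.Nat.Tactic.RingSolver

  -- A symmetric Hadamard matrix of order n = 2h with ±1 entries written as true/false: two rows are
  -- orthogonal iff they differ in exactly h places. The diagonal is +1 and every row sum is nonnegative.
  record Hadamard (n : ℕ) : Set where
    field
      half : ℕ
      order : n ≡ half + half
      matrix : Matrix n
      symmetric : SymmetricMatrix matrix
      reflexive : ReflexiveMatrix matrix
      heavy : ∀ x → half ≤ count (matrix x)
      orthogonal : ∀ x y → x ≢ y → distance (matrix x) (matrix y) ≡ half

  Hadamard⇒Gr : ∀ {n k} → Hadamard n → n < k + k → Σ (Graph n) (InGr n k)
  Hadamard⇒Gr {n} {k} H n<2k = separating⇒Gr matrix symmetric reflexive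
    ((λ x → subst (_< count (matrix x) + k) (sym order) (+-mono-≤-< (heavy x) h<k)) ,
     (λ x y x≢y → subst₂ (λ n c → n < c + k) (sym order) (sym (orthogonal x y x≢y)) (+-monoʳ-< half h<k)))
    where
    open Hadamard H
    h<k : half < k
    h<k = ≰⇒> λ k≤h → <⇒≱ n<2k (subst (k + k ≤_) (sym order) (+-mono-≤ k≤h k≤h))

  agreements : ∀ {n} (H : Hadamard n) → let open Hadamard H in
    ∀ x y → x ≢ y → count (not ∘ λ z → matrix x z xor matrix y z) ≡ half
  agreements H x y x≢y = +-cancelˡ-≡ half _ _ (begin
    half + count (not ∘ differ)              ≡⟨ cong (_+ count (not ∘ differ)) (orthogonal x y x≢y) ⟨
    count differ + count (not ∘ differ)      ≡⟨ count-complement differ ⟩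
    _                                        ≡⟨ order ⟩
    half + half                              ∎)
    where
    open Hadamard H
    open ≡-Reasoning
    differ = λ z → matrix x z xor matrix y z

  count-complement-of-empty : ∀ {n} (p : Fin n → Bool) → (∀ i → p i ≡ false) → count (not ∘ p) ≡ n
  count-complement-of-empty p empty = trans (sym (cong (_+ count (not ∘ p)) (count-false p empty))) (count-complement p)

  excess-cancels : ∀ {h} a c → h + a + c ≡ h + h → h ≡ c + a
  excess-cancels {h} a c eq = +-cancelˡ-≡ h _ _ (sym (trans (cong (h +_) (+-comm c a)) (trans (sym (+-assoc h a c)) eq)))

  -- (h + a)(h′ + b) + (h - a)(h′ - b) = 2hh′ + 2ab
  product-weight-bound : ∀ {h₁ h₂ w₁ w₁′ w₂ w₂′} → w₁ + w₁′ ≡ h₁ + h₁ → w₂ + w₂′ ≡ h₂ + h₂ →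
    h₁ ≤ w₁ → h₂ ≤ w₂ → (h₁ + h₁) * h₂ ≤ w₁ * w₂ + w₁′ * w₂′
  product-weight-bound {w₁′ = w₁′} {w₂′ = w₂′} sum₁ sum₂ h₁≤w₁ h₂≤w₂
    with m≤n⇒∃[o]m+o≡n h₁≤w₁ | m≤n⇒∃[o]m+o≡n h₂≤w₂
  ... | a , refl | b , refl with excess-cancels a w₁′ sum₁ | excess-cancels b w₂′ sum₂
  ... | refl | refl = ≤-trans (m≤m+n _ (2 * (a * b))) (≤-reflexive (expand w₁′ a w₂′ b))
    where
    expand : ∀ c a e b → (c + a + (c + a)) * (e + b) + 2 * (a * b) ≡ (c + a + a) * (e + b + b) + c * e
    expand = solve-∀

  module _ {m n : ℕ} where

    rowIndex : Fin (m * n) → Fin m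
    rowIndex z = proj₁ (remQuot {m} n z)

    columnIndex : Fin (m * n) → Fin n
    columnIndex z = proj₂ (remQuot {m} n z)

    count-pairs : ∀ (f : Fin m → Fin n → Bool) → count (λ z → f (rowIndex z) (columnIndex z)) ≡ sum (λ i → count (f i))
    count-pairs f = trans (sum-combine m n _)
      (sum-cong-≗ λ i → sum-cong-≗ λ j → cong (λ (i′ , j′) → indicator (f i′ j′)) (remQuot-combine i j))

    index-injective : ∀ {z z′} → rowIndex z ≡ rowIndex z′ → columnIndex z ≡ columnIndex z′ → z ≡ z′
    index-injective {z} {z′} i≡i′ j≡j′ =
      trans (sym (combine-remQuot {m} n z)) (trans (cong₂ combine i≡i′ j≡j′) (combine-remQuot {m} n z′))

  -- Multiplication of signs ±1, written as true/false.
  xnor : Bool → Bool → Bool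
  xnor a b = not (a xor b)

  xnor-xor-xnor : ∀ a b a′ b′ → xnor a b xor xnor a′ b′ ≡ (a xor a′) xor (b xor b′)
  xnor-xor-xnor true  true  true  true  = refl
  xnor-xor-xnor true  true  true  false = refl
  xnor-xor-xnor true  true  false true  = refl
  xnor-xor-xnor true  true  false false = refl
  xnor-xor-xnor true  false true  true  = refl
  xnor-xor-xnor true  false true  false = refl
  xnor-xor-xnor true  false false true  = refl
  xnor-xor-xnor true  false false false = refl
  xnor-xor-xnor false true  true  true  = refl
  xnor-xor-xnor false true  true  false = refl
  xnor-xor-xnor false true  false true  = refl
  xnor-xor-xnor false true  false false = refl
  xnor-xor-xnor false false true  true  = refl
  xnor-xor-xnor false false true  false = refl
  xnor-xor-xnor false false false true  = refl
  xnor-xor-xnor false false false false = refl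

  _⊗_ : ∀ {m n} → (Fin m → Bool) → (Fin n → Bool) → Fin (m * n) → Bool
  _⊗_ {m} {n} a b z = xnor (a (rowIndex {m} {n} z)) (b (columnIndex {m} {n} z))

  count-⊗ : ∀ {m n} (a : Fin m → Bool) (b : Fin n → Bool) →
    count (a ⊗ b) ≡ count a * count b + count (not ∘ a) * count (not ∘ b)
  count-⊗ a b = begin
    count (a ⊗ b)
      ≡⟨ count-pairs (λ i j → xnor (a i) (b j)) ⟩
    sum (λ i → count (λ j → xnor (a i) (b j)))
      ≡⟨ sum-cong-≗ (λ i → count-cong λ j → not-distribʳ-xor (a i) (b j)) ⟩
    sum (λ i → count (λ j → a i xor not (b j)))
      ≡⟨ sum-count-xor a (not ∘ b) ⟩
    count a * count (not ∘ not ∘ b) + count (not ∘ a) * count (not ∘ b)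
      ≡⟨ cong (λ c → count a * c + count (not ∘ a) * count (not ∘ b)) (count-cong (not-involutive ∘ b)) ⟩
    count a * count b + count (not ∘ a) * count (not ∘ b) ∎
    where open ≡-Reasoning

  distance-⊗ : ∀ {m n} (a a′ : Fin m → Bool) (b b′ : Fin n → Bool) →
    let u = λ i → a i xor a′ i; v = λ j → b j xor b′ j in
    distance (a ⊗ b) (a′ ⊗ b′) ≡ count u * count (not ∘ v) + count (not ∘ u) * count v
  distance-⊗ {m} {n} a a′ b b′ = begin
    distance (a ⊗ b) (a′ ⊗ b′)
      ≡⟨ count-cong (λ z → xnor-xor-xnor (a (i z)) (b (j z)) (a′ (i z)) (b′ (j z))) ⟩
    count (λ z → (a (i z) xor a′ (i z)) xor (b (j z) xor b′ (j z)))
      ≡⟨ count-pairs (λ i j → (a i xor a′ i) xor (b j xor b′ j)) ⟩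
    sum (λ i → count (λ j → (a i xor a′ i) xor (b j xor b′ j)))
      ≡⟨ sum-count-xor (λ i → a i xor a′ i) (λ j → b j xor b′ j) ⟩
    _ ∎
    where
    open ≡-Reasoning
    i = rowIndex {m} {n}
    j = columnIndex {m} {n}

  module _ {m n : ℕ} (A : Hadamard m) (B : Hadamard n) where
    private
      module A = Hadamard A
      module B = Hadamard B
      h₁ = A.half
      h₂ = B.half

    ⊗-heavy : ∀ x y → (h₁ + h₁) * h₂ ≤ count (A.matrix x ⊗ B.matrix y)
    ⊗-heavy x y = subst ((h₁ + h₁) * h₂ ≤_) (sym (count-⊗ (A.matrix x) (B.matrix y)))
      (product-weight-bound (trans (count-complement (A.matrix x)) A.order)
                            (trans (count-complement (B.matrix y)) B.order) (A.heavy x) (B.heavy y))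

    ⊗-orthogonal : ∀ {x x′ y y′} → ¬ (x ≡ x′ × y ≡ y′) →
      distance (A.matrix x ⊗ B.matrix y) (A.matrix x′ ⊗ B.matrix y′) ≡ (h₁ + h₁) * h₂
    ⊗-orthogonal {x} {x′} {y} {y′} distinct =
      trans (distance-⊗ (A.matrix x) (A.matrix x′) (B.matrix y) (B.matrix y′)) (by-cases (x ≟ x′) (y ≟ y′))
      where
      open ≡-Reasoning
      u = λ z → A.matrix x z xor A.matrix x′ z
      v = λ z → B.matrix y z xor B.matrix y′ z
      by-cases : Dec (x ≡ x′) → Dec (y ≡ y′) → count u * count (not ∘ v) + count (not ∘ u) * count v ≡ (h₁ + h₁) * h₂
      by-cases (yes x≡x′) (yes y≡y′) = ⊥-elim (distinct (x≡x′ , y≡y′))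
      by-cases (yes x≡x′) (no y≢y′) = begin
        count u * count (not ∘ v) + count (not ∘ u) * count v
          ≡⟨ cong₂ (λ c c′ → c * count (not ∘ v) + c′ * count v)
                   (count-false u u-empty) (count-complement-of-empty u u-empty) ⟩
        0 * count (not ∘ v) + m * count v
          ≡⟨ cong₂ (λ c c′ → 0 * count (not ∘ v) + c * c′) A.order (B.orthogonal y y′ y≢y′) ⟩
        (h₁ + h₁) * h₂                      ∎
        where
        u-empty : ∀ z → u z ≡ false
        u-empty z rewrite x≡x′ = xor-same (A.matrix x′ z)
      by-cases (no x≢x′) (yes y≡y′) = begin
        count u * count (not ∘ v) + count (not ∘ u) * count v
          ≡⟨ cong₂ (λ c c′ → count u * c + count (not ∘ u) * c′)
                   (count-complement-of-empty v v-empty) (count-false v v-empty) ⟩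
        count u * n + count (not ∘ u) * 0
          ≡⟨ cong₂ (λ c c′ → c * c′ + count (not ∘ u) * 0) (A.orthogonal x x′ x≢x′) B.order ⟩
        h₁ * (h₂ + h₂) + count (not ∘ u) * 0 ≡⟨ regroup h₁ h₂ (count (not ∘ u)) ⟩
        (h₁ + h₁) * h₂                      ∎
        where
        v-empty : ∀ z → v z ≡ false
        v-empty z rewrite y≡y′ = xor-same (B.matrix y′ z)
        regroup : ∀ a b c → a * (b + b) + c * 0 ≡ (a + a) * b
        regroup = solve-∀
      by-cases (no x≢x′) (no y≢y′) = begin
        count u * count (not ∘ v) + count (not ∘ u) * count v
          ≡⟨ cong₂ _+_ (cong₂ _*_ (A.orthogonal x x′ x≢x′) (agreements B y y′ y≢y′))
                       (cong₂ _*_ (agreements A x x′ x≢x′) (B.orthogonal y y′ y≢y′)) ⟩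
        h₁ * h₂ + h₁ * h₂                   ≡⟨ *-distribʳ-+ h₂ h₁ h₁ ⟨
        (h₁ + h₁) * h₂                      ∎

  -- In ±1 notation this is the Kronecker product of the two matrices.
  kronecker : ∀ {m n} → Hadamard m → Hadamard n → Hadamard (m * n)
  kronecker {m} {n} A B = record
    { half = (A.half + A.half) * B.half
    ; order = trans (cong₂ _*_ A.order B.order) (double A.half B.half)
    ; matrix = λ p → A.matrix (i p) ⊗ B.matrix (j p)
    ; symmetric = λ p q → cong₂ xnor (A.symmetric (i p) (i q)) (B.symmetric (j p) (j q))
    ; reflexive = λ p → cong₂ xnor (A.reflexive (i p)) (B.reflexive (j p))
    ; heavy = λ p → ⊗-heavy A B (i p) (j p)
    ; orthogonal = λ p q p≢q → ⊗-orthogonal A B λ (i≡ , j≡) → p≢q (index-injective i≡ j≡)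
    }
    where
    module A = Hadamard A
    module B = Hadamard B
    i = rowIndex {m} {n}
    j = columnIndex {m} {n}
    double : ∀ a b → (a + a) * (b + b) ≡ (a + a) * b + (a + a) * b
    double = solve-∀

  HadamardConditions : ∀ {n} → ℕ → Matrix n → Set
  HadamardConditions h M = SymmetricMatrix M × ReflexiveMatrix M ×
    (∀ x → h ≤ count (M x)) × (∀ x y → x ≢ y → distance (M x) (M y) ≡ h)

  hadamardConditions? : ∀ {n} h (M : Matrix n) → Dec (HadamardConditions h M)
  hadamardConditions? h M =
    all? (λ x → all? λ y → M x y ≟ᴮ M y x) ×-dec
    all? (λ x → M x x ≟ᴮ true) ×-dec
    all? (λ x → h ≤? count (M x)) ×-dec
    all? (λ x → all? λ y → ¬? (x ≟ y) →-dec (distance (M x) (M y) ≟ℕ h))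

  hadamard-by-decision : ∀ h (M : Matrix (h + h)) → True (hadamardConditions? h M) → Hadamard (h + h)
  hadamard-by-decision h M checked with toWitness checked
  ... | M-sym , M-refl , M-heavy , M-orthogonal =
    record { half = h ; order = refl ; matrix = M ; symmetric = M-sym ; reflexive = M-refl
           ; heavy = M-heavy ; orthogonal = M-orthogonal }

  hadamard₄ : Hadamard 4
  hadamard₄ = hadamard-by-decision 2 (λ x y → lookup (lookup rows x) y) _
    where
    rows : Vec (Vec Bool 4) 4
    rows = (true  ∷ true  ∷ false ∷ true  ∷ []) ∷
           (true  ∷ true  ∷ true  ∷ false ∷ []) ∷
           (false ∷ true  ∷ true  ∷ true  ∷ []) ∷
           (true  ∷ false ∷ true  ∷ true  ∷ []) ∷ []

  hadamard₃₆ : Hadamard 36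
  hadamard₃₆ = hadamard-by-decision 18 M _
    where
    row column diagonal : Fin 36 → ℕ
    row p = toℕ p / 6
    column p = toℕ p % 6
    diagonal p = (row p + column p) % 6
    _≠_ : ℕ → ℕ → Bool
    a ≠ b = not (a ≡ᵇ b)
    M : Matrix 36
    M p q = (toℕ p ≡ᵇ toℕ q) ∨ (row p ≠ row q ∧ column p ≠ column q ∧ diagonal p ≠ diagonal q)

  hadamard-4^a·36^b : ∀ a b → Hadamard (4 * (4 ^ a * 36 ^ b))
  hadamard-4^a·36^b zero zero = hadamard₄
  hadamard-4^a·36^b zero (suc b) = subst Hadamard (regroup (36 ^ b)) (kronecker (hadamard-4^a·36^b zero b) hadamard₃₆)
    where
    regroup : ∀ x → 4 * (1 * x) * 36 ≡ 4 * (1 * (36 * x))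
    regroup = solve-∀
  hadamard-4^a·36^b (suc a) b = subst Hadamard (regroup (4 ^ a) (36 ^ b)) (kronecker (hadamard-4^a·36^b a b) hadamard₄)
    where
    regroup : ∀ x y → 4 * (x * y) * 4 ≡ 4 * (4 * x * y)
    regroup = solve-∀

module Density where

  open import Data.Nat hiding (_≟_)
  open import Data.Nat.Properties hiding (_≟_)
  open import Data.Nat.Divisibility using (_∣_; divides; ∣m+n∣m⇒∣n; m∣m*n; ∣1⇒≡1)
  open import Data.Fin using (Fin; toℕ; fromℕ<)
  import Data.Fin as Fin
  open import Data.Fin.Properties using (toℕ<n; toℕ-fromℕ<; pigeonhole)
  open import Data.Product using (Σ; _×_; _,_; proj₁; proj₂)
  open import Data.Empty using (⊥-elim)
  open import Relation.Nullary using (¬_; yes; no)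
  open import Relation.Unary using (Decidable)
  open import Relation.Binary using (Tri; tri<; tri≈; tri>)
  open import Relation.Binary.PropositionalEquality
  open import Data.Nat.Tactic.RingSolver

  crossing : ∀ {P : ℕ → Set} → Decidable P → P 0 → ∀ N → ¬ P N → Σ ℕ λ t → t < N × P t × ¬ P (suc t)
  crossing P? P0 zero ¬P0 = ⊥-elim (¬P0 P0)
  crossing P? P0 (suc N) ¬P1+N with P? N
  ... | yes PN = N , ≤-refl , PN , ¬P1+N
  ... | no ¬PN = let (t , t<N , Pt , ¬P1+t) = crossing P? P0 N ¬PN in t , m≤n⇒m≤1+n t<N , Pt , ¬P1+t

  Smooth : ℕ → Set
  Smooth s = Σ ℕ λ a → Σ ℕ λ b → s ≡ 4 ^ a * 36 ^ b

  smooth-* : ∀ {s t} → Smooth s → Smooth t → Smooth (s * t)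
  smooth-* (a , b , refl) (c , d , refl) = a + c , b + d , (begin
    4 ^ a * 36 ^ b * (4 ^ c * 36 ^ d)    ≡⟨ interchange (4 ^ a) (36 ^ b) (4 ^ c) (36 ^ d) ⟩
    4 ^ a * 4 ^ c * (36 ^ b * 36 ^ d)    ≡⟨ cong₂ _*_ (^-distribˡ-+-* 4 a c) (^-distribˡ-+-* 36 b d) ⟨
    4 ^ (a + c) * 36 ^ (b + d)           ∎)
    where
    open ≡-Reasoning
    interchange : ∀ w x y z → w * x * (y * z) ≡ w * y * (x * z)
    interchange = solve-∀

  smooth-^ : ∀ {s} → Smooth s → ∀ t → Smooth (s ^ t)
  smooth-^ smooth zero = 0 , 0 , refl
  smooth-^ smooth (suc t) = smooth-* smooth (smooth-^ smooth t)

  smooth-4^ : ∀ c → Smooth (4 ^ c)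
  smooth-4^ c = c , 0 , sym (*-identityʳ (4 ^ c))

  smooth-36^ : ∀ c → Smooth (36 ^ c)
  smooth-36^ c = 0 , c , sym (+-identityʳ (36 ^ c))

  smooth-positive : ∀ {s} → Smooth s → 0 < s
  smooth-positive (a , b , refl) = *-mono-≤ (m^n>0 4 a) (m^n>0 36 b)

  3∤4^ : ∀ c → ¬ 3 ∣ 4 ^ c
  3∤4^ zero 3∣1 with ∣1⇒≡1 3∣1
  ... | ()
  3∤4^ (suc c) 3∣4^[1+c] = 3∤4^ c (∣m+n∣m⇒∣n (subst (3 ∣_) (split (4 ^ c)) 3∣4^[1+c]) (m∣m*n (4 ^ c)))
    where
    split : ∀ x → 4 * x ≡ 3 * x + x
    split = solve-∀

  -- 3 divides 36 but not 4.
  36^-4^-distinct : ∀ {q₁ q₂} c₁ c₂ → q₁ < q₂ → 36 ^ q₁ * 4 ^ c₁ ≢ 36 ^ q₂ * 4 ^ c₂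
  36^-4^-distinct {q₁} {q₂} c₁ c₂ q₁<q₂ eq with m≤n⇒∃[o]m+o≡n q₁<q₂
  ... | d , refl = 3∤4^ c₁ (divides (12 * (36 ^ d * 4 ^ c₂)) (*-cancelˡ-≡ (4 ^ c₁) _ (36 ^ q₁) {{m^n≢0 36 q₁}} (begin
    36 ^ q₁ * 4 ^ c₁                               ≡⟨ eq ⟩
    36 ^ (suc q₁ + d) * 4 ^ c₂                     ≡⟨ cong (_* 4 ^ c₂) (^-distribˡ-+-* 36 (suc q₁) d) ⟩
    36 * 36 ^ q₁ * 36 ^ d * 4 ^ c₂                 ≡⟨ regroup (36 ^ q₁) (36 ^ d) (4 ^ c₂) ⟩
    36 ^ q₁ * (12 * (36 ^ d * 4 ^ c₂) * 3)         ∎)))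
    where
    open ≡-Reasoning
    regroup : ∀ x y z → 36 * x * y * z ≡ x * (12 * (y * z) * 3)
    regroup = solve-∀

  bernoulli : ∀ u e m → u ^ suc m + m * e * u ^ m ≤ u * (u + e) ^ m
  bernoulli u e zero = ≤-reflexive (+-identityʳ _)
  bernoulli u e (suc m) = begin
    u * (u * u ^ m) + suc m * e * (u * u ^ m)                            ≤⟨ m≤m+n _ (m * e * e * u ^ m) ⟩
    u * (u * u ^ m) + suc m * e * (u * u ^ m) + m * e * e * u ^ m        ≡⟨ factor u e m (u ^ m) ⟩
    (u + e) * (u * u ^ m + m * e * u ^ m)                                ≤⟨ *-monoʳ-≤ (u + e) (bernoulli u e m) ⟩
    (u + e) * (u * (u + e) ^ m)                                          ≡⟨ x*[y*z]≡y*[x*z] (u + e) u ((u + e) ^ m) ⟩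
    u * ((u + e) * (u + e) ^ m)                                          ∎
    where
    open ≤-Reasoning
    factor : ∀ u e m p → u * (u * p) + suc m * e * (u * p) + m * e * e * p ≡ (u + e) * (u * p + m * e * p)
    factor = solve-∀
    x*[y*z]≡y*[x*z] : ∀ x y z → x * (y * z) ≡ y * (x * z)
    x*[y*z]≡y*[x*z] = solve-∀

  m<4*m : ∀ {m} → 0 < m → m < 4 * m
  m<4*m {m} 0<m = m<m+n m (≤-trans 0<m (m≤m+n m (2 * m)))

  CloseSmoothPair : ℕ → Set
  CloseSmoothPair D = Σ ℕ λ u → Σ ℕ λ v → Smooth u × Smooth v × u < v × v * D < u * suc D

  -- Dirichlet's argument: scale each 36^q (q ≤ 2D) by a power of 4 into [X, 4X); as (1 + 1/D)^(2D) ≥ 4,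
  -- the 2D intervals [X (1 + 1/D)^i, X (1 + 1/D)^(i+1)) cover [X, 4X), so two of them share an interval.
  module Dirichlet (D : ℕ) (1≤D : 1 ≤ D) where

    L = D + D
    X = 4 ^ (3 * L)

    36^q<4X : ∀ q → q ≤ L → 36 ^ q < 4 * X
    36^q<4X q q≤L = begin-strict
      36 ^ q       ≤⟨ ^-monoʳ-≤ 36 q≤L ⟩
      36 ^ L       ≤⟨ ^-monoˡ-≤ L (m≤m+n 36 28) ⟩
      64 ^ L       ≡⟨ ^-*-assoc 4 3 L ⟩
      X            <⟨ m<4*m (m^n>0 4 (3 * L)) ⟩
      4 * X        ∎
      where open ≤-Reasoning

    normalise : ∀ m → 0 < m → m < 4 * X → Σ ℕ λ c → X ≤ m * 4 ^ c × m * 4 ^ c < 4 * X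
    normalise m 0<m m<4X with crossing (λ c → m * 4 ^ c <? 4 * X) (subst (_< 4 * X) (sym (*-identityʳ m)) m<4X)
                                      (suc (3 * L)) (λ lt → <⇒≱ lt (m≤n*m (4 ^ suc (3 * L)) m {{>-nonZero 0<m}}))
    ... | c , _ , below , ¬below =
      c , *-cancelˡ-≤ 4 (≤-trans (≮⇒≥ ¬below) (≤-reflexive (x*[y*z]≡y*[x*z] m 4 (4 ^ c)))) , below
      where
      x*[y*z]≡y*[x*z] : ∀ x y z → x * (y * z) ≡ y * (x * z)
      x*[y*z]≡y*[x*z] = solve-∀

    Bucket : ℕ → ℕ → Set
    Bucket v i = X * suc D ^ i ≤ v * D ^ i

    2D^D≤[1+D]^D : 2 * D ^ D ≤ suc D ^ D
    2D^D≤[1+D]^D = *-cancelʳ-≤ (2 * D ^ D) (suc D ^ D) D {{>-nonZero 1≤D}}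
      (subst₂ _≤_ (regroup D (D ^ D)) (trans (cong (λ x → D * x ^ D) (+-comm D 1)) (*-comm D (suc D ^ D))) (bernoulli D 1 D))
      where
      regroup : ∀ d p → d * p + d * 1 * p ≡ 2 * p * d
      regroup = solve-∀

    4D^L≤[1+D]^L : 4 * D ^ L ≤ suc D ^ L
    4D^L≤[1+D]^L = begin
      4 * D ^ L                        ≡⟨ cong (4 *_) (^-distribˡ-+-* D D D) ⟩
      4 * (D ^ D * D ^ D)              ≡⟨ regroup (D ^ D) ⟩
      2 * D ^ D * (2 * D ^ D)          ≤⟨ *-mono-≤ 2D^D≤[1+D]^D 2D^D≤[1+D]^D ⟩
      suc D ^ D * suc D ^ D            ≡⟨ ^-distribˡ-+-* (suc D) D D ⟨
      suc D ^ L                        ∎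
      where
      open ≤-Reasoning
      regroup : ∀ p → 4 * (p * p) ≡ 2 * p * (2 * p)
      regroup = solve-∀

    bucket : ∀ v → X ≤ v → v < 4 * X → Σ ℕ λ i → i < L × Bucket v i × ¬ Bucket v (suc i)
    bucket v X≤v v<4X = crossing (λ i → X * suc D ^ i ≤? v * D ^ i) (*-monoˡ-≤ 1 X≤v) L beyond
      where
      beyond : ¬ Bucket v L
      beyond bucketL = <⇒≱ (begin-strict
        v * D ^ L             <⟨ *-monoˡ-< (D ^ L) {{m^n≢0 D L {{>-nonZero 1≤D}}}} v<4X ⟩
        4 * X * D ^ L         ≡⟨ regroup X (D ^ L) ⟩
        X * (4 * D ^ L)       ≤⟨ *-monoʳ-≤ X 4D^L≤[1+D]^L ⟩
        X * suc D ^ L         ∎) bucketL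
        where
        open ≤-Reasoning
        regroup : ∀ x p → 4 * x * p ≡ x * (4 * p)
        regroup = solve-∀

    same-bucket⇒close : ∀ v w i → Bucket v i → ¬ Bucket w (suc i) → w * D < v * suc D
    same-bucket⇒close v w i v∈i w∉1+i = *-cancelʳ-< (D ^ i) (w * D) (v * suc D) (begin-strict
      w * D * D ^ i                 ≡⟨ *-assoc w D (D ^ i) ⟩
      w * D ^ suc i                 <⟨ ≰⇒> w∉1+i ⟩
      X * suc D ^ suc i             ≡⟨ x*[y*z]≡y*[x*z] X (suc D) (suc D ^ i) ⟩
      suc D * (X * suc D ^ i)       ≤⟨ *-monoʳ-≤ (suc D) v∈i ⟩
      suc D * (v * D ^ i)           ≡⟨ regroup (suc D) v (D ^ i) ⟩
      v * suc D * D ^ i             ∎)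
      where
      open ≤-Reasoning
      x*[y*z]≡y*[x*z] : ∀ x y z → x * (y * z) ≡ y * (x * z)
      x*[y*z]≡y*[x*z] = solve-∀
      regroup : ∀ s v p → s * (v * p) ≡ v * s * p
      regroup = solve-∀

    record Placement (q : ℕ) : Set where
      field
        exponent index : ℕ
        index<L : index < L
        lower : Bucket (36 ^ q * 4 ^ exponent) index
        upper : ¬ Bucket (36 ^ q * 4 ^ exponent) (suc index)
    open Placement

    place : ∀ q → q ≤ L → Placement q
    place q q≤L = record { exponent = c ; index = i ; index<L = i<L ; lower = m∈i ; upper = m∉1+i }
      where
      normalised = normalise (36 ^ q) (m^n>0 36 q) (36^q<4X q q≤L)
      c = proj₁ normalised
      bucketed = bucket (36 ^ q * 4 ^ c) (proj₁ (proj₂ normalised)) (proj₂ (proj₂ normalised))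
      i = proj₁ bucketed
      i<L = proj₁ (proj₂ bucketed)
      m∈i = proj₁ (proj₂ (proj₂ bucketed))
      m∉1+i = proj₂ (proj₂ (proj₂ bucketed))

    shared-bucket⇒close-pair : ∀ {q₁ q₂} → q₁ < q₂ → (P₁ : Placement q₁) (P₂ : Placement q₂) →
      index P₁ ≡ index P₂ → CloseSmoothPair D
    shared-bucket⇒close-pair {q₁} {q₂} q₁<q₂ P₁ P₂ i₁≡i₂ = by-order (<-cmp m₁ m₂)
      where
      m₁ = 36 ^ q₁ * 4 ^ exponent P₁
      m₂ = 36 ^ q₂ * 4 ^ exponent P₂
      smooth₁ = smooth-* (smooth-36^ q₁) (smooth-4^ (exponent P₁))
      smooth₂ = smooth-* (smooth-36^ q₂) (smooth-4^ (exponent P₂))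
      by-order : Tri (m₁ < m₂) (m₁ ≡ m₂) (m₂ < m₁) → CloseSmoothPair D
      by-order (tri< m₁<m₂ _ _) = m₁ , m₂ , smooth₁ , smooth₂ , m₁<m₂ ,
        same-bucket⇒close m₁ m₂ (index P₁) (lower P₁) (subst (λ i → ¬ Bucket m₂ (suc i)) (sym i₁≡i₂) (upper P₂))
      by-order (tri≈ _ m₁≡m₂ _) = ⊥-elim (36^-4^-distinct (exponent P₁) (exponent P₂) q₁<q₂ m₁≡m₂)
      by-order (tri> _ _ m₂<m₁) = m₂ , m₁ , smooth₂ , smooth₁ , m₂<m₁ ,
        same-bucket⇒close m₂ m₁ (index P₂) (lower P₂) (subst (λ i → ¬ Bucket m₁ (suc i)) i₁≡i₂ (upper P₁))

    close-pair : CloseSmoothPair D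
    close-pair = from-collision (pigeonhole (n<1+n L) (λ q → fromℕ< (index<L (placement q))))
      where
      placement : (q : Fin (suc L)) → Placement (toℕ q)
      placement q = place (toℕ q) (m<1+n⇒m≤n (toℕ<n q))
      from-collision : (Σ (Fin (suc L)) λ q₁ → Σ (Fin (suc L)) λ q₂ →
        q₁ Fin.< q₂ × fromℕ< (index<L (placement q₁)) ≡ fromℕ< (index<L (placement q₂))) → CloseSmoothPair D
      from-collision (q₁ , q₂ , q₁<q₂ , same) = shared-bucket⇒close-pair q₁<q₂ (placement q₁) (placement q₂)
        (trans (sym (toℕ-fromℕ< (index<L (placement q₁)))) (trans (cong toℕ same) (toℕ-fromℕ< (index<L (placement q₂)))))

  n<4^n : ∀ n → n < 4 ^ n
  n<4^n zero = s≤s z≤n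
  n<4^n (suc n) = +-mono-≤ (m^n>0 4 n) (≤-trans (n<4^n n) (m≤m+n (4 ^ n) (2 * 4 ^ n)))

  -- Between consecutive powers of 4 the ladder u^(T-t) v^t climbs by the ratio v/u < 1 + 1/D,
  -- and its T = 3u steps span a factor (v/u)^T ≥ (1 + 1/u)^(3u) ≥ 4.
  module Ladder (D : ℕ) (1≤D : 1 ≤ D) {u v : ℕ} (smooth-u : Smooth u) (smooth-v : Smooth v)
                (u<v : u < v) (close : v * D < u * suc D) where

    T = 3 * u

    0<u : 0 < u
    0<u = smooth-positive smooth-u

    4u^T≤v^T : 4 * u ^ T ≤ v ^ T
    4u^T≤v^T with m≤n⇒∃[o]m+o≡n (<⇒≤ u<v)
    ... | e , u+e≡v = *-cancelʳ-≤ (4 * u ^ T) (v ^ T) u {{>-nonZero 0<u}} (begin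
      4 * u ^ T * u                          ≡⟨ regroup u (u ^ T) ⟩
      u * u ^ T + T * 1 * u ^ T              ≤⟨ +-monoʳ-≤ (u * u ^ T) (*-monoˡ-≤ (u ^ T) (*-monoʳ-≤ T 1≤e)) ⟩
      u * u ^ T + T * e * u ^ T              ≤⟨ bernoulli u e T ⟩
      u * (u + e) ^ T                        ≡⟨ cong (λ w → u * w ^ T) u+e≡v ⟩
      u * v ^ T                              ≡⟨ *-comm u (v ^ T) ⟩
      v ^ T * u                              ∎)
      where
      open ≤-Reasoning
      1≤e : 1 ≤ e
      1≤e = +-cancelˡ-≤ u 1 e (subst₂ _≤_ (+-comm 1 u) (sym u+e≡v) u<v)
      regroup : ∀ u p → 4 * p * u ≡ u * p + 3 * u * 1 * p
      regroup = solve-∀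

    rung : ℕ → ℕ → ℕ
    rung c t = u ^ (T ∸ t) * v ^ t * 4 ^ c

    smooth-rung : ∀ c t → Smooth (rung c t)
    smooth-rung c t = smooth-* (smooth-* (smooth-^ smooth-u (T ∸ t)) (smooth-^ smooth-v t)) (smooth-4^ c)

    rung-step : ∀ c t → t < T → rung c (suc t) * u ≡ rung c t * v
    rung-step c t t<T = begin
      u ^ (T ∸ suc t) * (v * v ^ t) * 4 ^ c * u           ≡⟨ swap u v (u ^ (T ∸ suc t)) (v ^ t) (4 ^ c) ⟩
      u * u ^ (T ∸ suc t) * v ^ t * 4 ^ c * v             ≡⟨ cong (λ r → u ^ r * v ^ t * 4 ^ c * v) (+-∸-assoc 1 t<T) ⟨
      u ^ (T ∸ t) * v ^ t * 4 ^ c * v                     ∎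
      where
      open ≡-Reasoning
      swap : ∀ u v p q r → p * (v * q) * r * u ≡ u * p * q * r * v
      swap = solve-∀

    rung-close : ∀ X c t → t < T → X < 4 * rung c (suc t) → X * D < 4 * rung c t * suc D
    rung-close X c t t<T X<next = *-cancelʳ-< u (X * D) (s * suc D) (begin-strict
      X * D * u                  ≡⟨ x*y*z≡x*z*y X D u ⟩
      X * u * D                  <⟨ *-monoˡ-< D {{>-nonZero 1≤D}} (begin-strict
                                      X * u                           <⟨ *-monoˡ-< u {{>-nonZero 0<u}} X<next ⟩
                                      4 * rung c (suc t) * u          ≡⟨ *-assoc 4 (rung c (suc t)) u ⟩
                                      4 * (rung c (suc t) * u)        ≡⟨ cong (4 *_) (rung-step c t t<T) ⟩
                                      4 * (rung c t * v)              ≡⟨ *-assoc 4 (rung c t) v ⟨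
                                      s * v                           ∎) ⟩
      s * v * D                  ≡⟨ *-assoc s v D ⟩
      s * (v * D)                ≤⟨ *-monoʳ-≤ s (<⇒≤ close) ⟩
      s * (u * suc D)            ≡⟨ x*[y*z]≡x*z*y s u (suc D) ⟩
      s * suc D * u              ∎)
      where
      open ≤-Reasoning
      s = 4 * rung c t
      x*y*z≡x*z*y : ∀ x y z → x * y * z ≡ x * z * y
      x*y*z≡x*z*y = solve-∀
      x*[y*z]≡x*z*y : ∀ x y z → x * (y * z) ≡ x * z * y
      x*[y*z]≡x*z*y = solve-∀

    level : ∀ X → u ^ T * 4 ^ 1 ≤ X → Σ ℕ λ c → u ^ T * 4 ^ suc c ≤ X × ¬ (u ^ T * 4 ^ suc (suc c) ≤ X)
    level X start≤X with crossing (λ c → u ^ T * 4 ^ suc c ≤? X) start≤X X too-high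
      where
      too-high : ¬ (u ^ T * 4 ^ suc X ≤ X)
      too-high = <⇒≱ (<-≤-trans (<-≤-trans (n<4^n X) (^-monoʳ-≤ 4 (n≤1+n X)))
                                  (m≤n*m (4 ^ suc X) (u ^ T) {{m^n≢0 u T {{>-nonZero 0<u}}}}))
    ... | c , _ , within , ¬above = c , within , ¬above

    climb : ∀ X c → u ^ T * 4 ^ suc c ≤ X → ¬ (u ^ T * 4 ^ suc (suc c) ≤ X) →
      Σ ℕ λ s → Smooth s × 4 * s ≤ X × X * D < 4 * s * suc D
    climb X c within ¬above = final (crossing (λ t → 4 * rung c t ≤? X) bottom T top)
      where
      bottom : 4 * rung c 0 ≤ X
      bottom = subst (_≤ X) (regroup (u ^ T) (4 ^ c)) within
        where
        regroup : ∀ p q → p * (4 * q) ≡ 4 * (p * 1 * q)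
        regroup = solve-∀
      top : ¬ (4 * rung c T ≤ X)
      top above = ¬above (begin
        u ^ T * (4 * (4 * 4 ^ c))        ≡⟨ regroup (u ^ T) (4 ^ c) ⟩
        4 * (4 * u ^ T * 4 ^ c)          ≤⟨ *-monoʳ-≤ 4 (*-monoˡ-≤ (4 ^ c) 4u^T≤v^T) ⟩
        4 * (v ^ T * 4 ^ c)              ≡⟨ cong (λ w → 4 * (w * 4 ^ c)) (*-identityˡ (v ^ T)) ⟨
        4 * (1 * v ^ T * 4 ^ c)          ≡⟨ cong (λ r → 4 * (u ^ r * v ^ T * 4 ^ c)) (n∸n≡0 T) ⟨
        4 * rung c T                     ≤⟨ above ⟩
        X                                ∎)
        where
        open ≤-Reasoning
        regroup : ∀ p q → p * (4 * (4 * q)) ≡ 4 * (4 * p * q)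
        regroup = solve-∀
      final : (Σ ℕ λ t → t < T × 4 * rung c t ≤ X × ¬ (4 * rung c (suc t) ≤ X)) →
        Σ ℕ λ s → Smooth s × 4 * s ≤ X × X * D < 4 * s * suc D
      final (t , t<T , below , ¬below) = rung c t , smooth-rung c t , below , rung-close X c t t<T (≰⇒> ¬below)

    covering : ∀ X → u ^ T * 4 ≤ X → Σ ℕ λ s → Smooth s × 4 * s ≤ X × X * D < 4 * s * suc D
    covering X start≤X = let (c , within , ¬above) = level X start≤X in climb X c within ¬above

  near-double : ∀ Q k s X → 1 ≤ Q → 4 * Q ≤ k → suc X ≡ k + k → s ≤ X → X * (4 * Q) < s * suc (4 * Q) →
    s < k + k × k ≤ s × Q * (k + k ∸ s) < k
  near-double Q k s X 1≤Q 4Q≤k 1+X≡2k s≤X X4Q<s[1+4Q] = s<2k , k≤s , Q*gap<k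
    where
    r = X ∸ s
    s+r≡X : s + r ≡ X
    s+r≡X = m+[n∸m]≡n s≤X
    r*4Q<s : r * (4 * Q) < s
    r*4Q<s = +-cancelˡ-< (s * (4 * Q)) (r * (4 * Q)) s (subst₂ _<_
      (trans (cong (_* (4 * Q)) (sym s+r≡X)) (*-distribʳ-+ (4 * Q) s r)) (trans (*-suc s (4 * Q)) (+-comm s _)) X4Q<s[1+4Q])
    gap≡1+r : k + k ∸ s ≡ suc r
    gap≡1+r = trans (cong (_∸ s) (sym 1+X≡2k)) (+-∸-assoc 1 s≤X)
    s+[1+r]≡2k : s + suc r ≡ k + k
    s+[1+r]≡2k = trans (+-suc s r) (trans (cong suc s+r≡X) 1+X≡2k)
    Q*[1+r]<k : Q * suc r < k
    Q*[1+r]<k = *-cancelˡ-< 4 (Q * suc r) k (begin-strict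
      4 * (Q * suc r)            ≡⟨ regroup Q r ⟩
      r * (4 * Q) + 4 * Q        <⟨ +-monoˡ-< (4 * Q) r*4Q<s ⟩
      s + 4 * Q                  ≤⟨ +-mono-≤ (m≤m+n s (suc r)) 4Q≤k ⟩
      s + suc r + k              ≡⟨ cong (_+ k) s+[1+r]≡2k ⟩
      k + k + k                  <⟨ m<m+n (k + k + k) (≤-trans 1≤Q (≤-trans (m≤m+n Q (3 * Q)) 4Q≤k)) ⟩
      k + k + k + k              ≡⟨ four-times k ⟩
      4 * k                      ∎)
      where
      open ≤-Reasoning
      regroup : ∀ Q r → 4 * (Q * suc r) ≡ r * (4 * Q) + 4 * Q
      regroup = solve-∀
      four-times : ∀ k → k + k + k + k ≡ 4 * k
      four-times = solve-∀
    Q*gap<k : Q * (k + k ∸ s) < k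
    Q*gap<k = subst (λ g → Q * g < k) (sym gap≡1+r) Q*[1+r]<k
    1+r<k : suc r < k
    1+r<k = ≤-<-trans (m≤n*m (suc r) Q {{>-nonZero 1≤Q}}) Q*[1+r]<k
    s<2k : s < k + k
    s<2k = subst (s <_) s+[1+r]≡2k (m<m+n s (s≤s z≤n))
    k≤s : k ≤ s
    k≤s = <⇒≤ (+-cancelʳ-< k k s (subst (_< s + k) s+[1+r]≡2k (+-monoʳ-< s 1+r<k)))

  near-double-smooth : ∀ Q → 1 ≤ Q → Σ ℕ λ K → ∀ k → K ≤ k →
    Σ ℕ λ s → Smooth s × 4 * s < k + k × k ≤ 4 * s × Q * (k + k ∸ 4 * s) < k
  near-double-smooth Q 1≤Q = from-pair (Dirichlet.close-pair (4 * Q) 1≤4Q)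
    where
    1≤4Q : 1 ≤ 4 * Q
    1≤4Q = ≤-trans 1≤Q (m≤m+n Q (3 * Q))
    from-pair : CloseSmoothPair (4 * Q) → Σ ℕ λ K → ∀ k → K ≤ k →
      Σ ℕ λ s → Smooth s × 4 * s < k + k × k ≤ 4 * s × Q * (k + k ∸ 4 * s) < k
    from-pair (u , v , smooth-u , smooth-v , u<v , close) = start + 4 * Q , near
      where
      open Ladder (4 * Q) 1≤4Q smooth-u smooth-v u<v close using (T; covering)
      start = u ^ T * 4
      near : ∀ k → start + 4 * Q ≤ k → Σ ℕ λ s → Smooth s × 4 * s < k + k × k ≤ 4 * s × Q * (k + k ∸ 4 * s) < k
      near k K≤k = let (s , smooth-s , 4s≤X , close-below) = covering X start≤X in
        s , smooth-s , near-double Q k (4 * s) X 1≤Q 4Q≤k 1+X≡2k 4s≤X close-below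
        where
        0<k : 0 < k
        0<k = ≤-trans 1≤4Q (≤-trans (m≤n+m (4 * Q) start) K≤k)
        X = k + k ∸ 1
        1+X≡2k : suc X ≡ k + k
        1+X≡2k = m+[n∸m]≡n (≤-trans 0<k (m≤m+n k k))
        4Q≤k : 4 * Q ≤ k
        4Q≤k = ≤-trans (m≤n+m (4 * Q) start) K≤k
        start≤X : start ≤ X
        start≤X = ≤-trans (≤-trans (m≤m+n start (4 * Q)) K≤k)
                          (≤-trans (m≤m+n k (k ∸ 1)) (≤-reflexive (sym (+-∸-assoc k 0<k))))

module LowerBound where

  open import Defs hiding (sym)
  open Existence
  open HadamardMatrices
  open Density
  open import Data.Nat hiding (_≟_)
  open import Data.Nat.Properties hiding (_≟_)
  open import Data.Product using (Σ; _×_; _,_; proj₁; proj₂)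
  open import Relation.Binary.PropositionalEquality

  smooth⇒hadamard : ∀ {s} → Smooth s → Hadamard (4 * s)
  smooth⇒hadamard (a , b , refl) = hadamard-4^a·36^b a b

  Ξ-near-double : ∀ Q → 1 ≤ Q → Σ ℕ λ K → ∀ k → K ≤ k → 2 ≤ k → ∀ m → IsXi k m →
    m ≤ 2 * k × Q * (2 * k ∸ m) < k
  Ξ-near-double Q 1≤Q = proj₁ density , λ k K≤k 2≤k m Ξk≡m → bound k 2≤k m Ξk≡m (proj₂ density k K≤k)
    where
    density = near-double-smooth Q 1≤Q
    bound : ∀ k → 2 ≤ k → ∀ m → IsXi k m →
      (Σ ℕ λ s → Smooth s × 4 * s < k + k × k ≤ 4 * s × Q * (k + k ∸ 4 * s) < k) → m ≤ 2 * k × Q * (2 * k ∸ m) < k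
    bound k 2≤k m (nonempty , maximal) (s , smooth , 4s<2k , k≤4s , gap<k) =
      ≤-trans (m≤m+n m 2) (GrNonempty-order-bound 2≤k nonempty) , ≤-<-trans (*-monoʳ-≤ Q gap-shrinks) gap<k
      where
      4s≤m : 4 * s ≤ m
      4s≤m = maximal (4 * s) (k≤4s , Hadamard⇒Gr (smooth⇒hadamard smooth) 4s<2k)
      gap-shrinks : 2 * k ∸ m ≤ k + k ∸ 4 * s
      gap-shrinks = subst (λ n → n ∸ m ≤ k + k ∸ 4 * s) (sym (cong (k +_) (+-identityʳ k))) (∸-monoʳ-≤ (k + k) 4s≤m)

module RationalBound where

  open import Data.Nat using (ℕ; suc; _≤_; _∸_; s≤s; z≤n)
  import Data.Nat as ℕ
  import Data.Nat.Properties as ℕ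
  open import Data.Integer using (+_; +[1+_]; -[1+_])
  import Data.Integer as ℤ
  import Data.Integer.Properties as ℤ
  open import Data.Rational using (ℚ; mkℚ; _/_; _-_; ∣_∣; _<_; _*_; 0ℚ; toℚᵘ; *<*)
  open import Data.Rational.Properties using (normalize-coprime; toℚᵘ-cancel-<; toℚᵘ-homo-+; toℚᵘ-homo‿-; toℚᵘ-homo-*)
  import Data.Rational.Unnormalised as ℚᵘ
  import Data.Rational.Unnormalised.Properties as ℚᵘ
  open import Data.Nat.Coprimality using (Coprime; 1-coprimeTo)
  import Data.Nat.Coprimality as Coprime
  open import Data.Product using (Σ; _×_; _,_)
  open import Relation.Binary.PropositionalEquality

  coprime-to-1 : ∀ m → Coprime m 1
  coprime-to-1 m = Coprime.sym (1-coprimeTo m)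

  integral : ℕ → ℚ
  integral m = mkℚ (+ m) 0 (coprime-to-1 m)

  /1≡integral : ∀ m → (+ m) / 1 ≡ integral m
  /1≡integral m = normalize-coprime (coprime-to-1 m)

  toℚᵘ-∣∣ : ∀ p → toℚᵘ ∣ p ∣ ≡ ℚᵘ.∣ toℚᵘ p ∣
  toℚᵘ-∣∣ (mkℚ n d c) = refl

  -- The numerator of toℚᵘ (m / 1) - toℚᵘ (n / 1), in absolute value.
  ∣m-n∣≡n∸m : ∀ m n → m ≤ n → ℤ.∣ + m ℤ.* + 1 ℤ.+ ℤ.- + n ℤ.* + 1 ∣ ≡ n ∸ m
  ∣m-n∣≡n∸m m n m≤n = begin
    ℤ.∣ + m ℤ.* + 1 ℤ.+ ℤ.- + n ℤ.* + 1 ∣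
      ≡⟨ cong₂ (λ a b → ℤ.∣ a ℤ.+ b ∣) (ℤ.*-identityʳ (+ m)) (ℤ.*-identityʳ (ℤ.- + n)) ⟩
    ℤ.∣ + m ℤ.+ ℤ.- + n ∣                   ≡⟨ cong ℤ.∣_∣ (ℤ.m-n≡m⊖n m n) ⟩
    ℤ.∣ m ℤ.⊖ n ∣                           ≡⟨ cong ℤ.∣_∣ (ℤ.⊖-≤ m≤n) ⟩
    ℤ.∣ ℤ.- + (n ∸ m) ∣                     ≡⟨ ℤ.∣-i∣≡∣i∣ (+ (n ∸ m)) ⟩
    n ∸ m                                   ∎
    where open ≡-Reasoning

  toℚᵘ-homo-difference : ∀ p q → toℚᵘ (p - q) ℚᵘ.≃ toℚᵘ p ℚᵘ.- toℚᵘ q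
  toℚᵘ-homo-difference p q = ℚᵘ.≃-trans (toℚᵘ-homo-+ p (Data.Rational.- q)) (ℚᵘ.+-congʳ (toℚᵘ p) (toℚᵘ-homo‿- q))

  -- For ε = (1 + p)/(1 + d) it suffices that (1 + d)(n - m) < k.
  close-by-denominator : ∀ (ε : ℚ) → 0ℚ < ε → Σ ℕ λ Q → 1 ≤ Q ×
    (∀ m n k → m ≤ n → Q ℕ.* (n ∸ m) ℕ.< k → ∣ (+ m / 1) - (+ n / 1) ∣ < ε * (+ k / 1))
  close-by-denominator (mkℚ (+ 0) d c) (*<* (ℤ.+<+ ()))
  close-by-denominator (mkℚ -[1+ n ] d c) (*<* ())
  close-by-denominator ε@(mkℚ +[1+ p ] d c) _ = suc d , s≤s z≤n , λ m n k m≤n gap<k →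
    subst₂ (λ a b → ∣ a - b ∣ < ε * (+ k / 1)) (sym (/1≡integral m)) (sym (/1≡integral n))
      (subst (λ b → ∣ integral m - integral n ∣ < ε * b) (sym (/1≡integral k))
        (toℚᵘ-cancel-< (unnormalised m n k m≤n gap<k)))
    where
    unnormalised : ∀ m n k → m ≤ n → suc d ℕ.* (n ∸ m) ℕ.< k →
      toℚᵘ ∣ integral m - integral n ∣ ℚᵘ.< toℚᵘ (ε * integral k)
    unnormalised m n k m≤n gap<k = begin-strict
      toℚᵘ ∣ integral m - integral n ∣                          ≡⟨ toℚᵘ-∣∣ (integral m - integral n) ⟩
      ℚᵘ.∣ toℚᵘ (integral m - integral n) ∣                      ≃⟨ ℚᵘ.∣-∣-cong (toℚᵘ-homo-difference (integral m) (integral n)) ⟩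
      ℚᵘ.∣ toℚᵘ (integral m) ℚᵘ.- toℚᵘ (integral n) ∣            <⟨ ℚᵘ.*<* (subst₂ ℤ._<_ lhs rhs (ℤ.+<+ gap*d<[1+p]*k)) ⟩
      toℚᵘ ε ℚᵘ.* toℚᵘ (integral k)                              ≃⟨ toℚᵘ-homo-* ε (integral k) ⟨
      toℚᵘ (ε * integral k)                                      ∎
      where
      open ℚᵘ.≤-Reasoning
      gap*d<[1+p]*k : (n ∸ m) ℕ.* (suc d ℕ.* 1) ℕ.< suc p ℕ.* k
      gap*d<[1+p]*k = ℕ.<-≤-trans (subst (ℕ._< k) reorder gap<k) (ℕ.m≤n*m k (suc p))
        where
        reorder : suc d ℕ.* (n ∸ m) ≡ (n ∸ m) ℕ.* (suc d ℕ.* 1)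
        reorder = trans (ℕ.*-comm (suc d) (n ∸ m)) (cong ((n ∸ m) ℕ.*_) (sym (ℕ.*-identityʳ (suc d))))
      lhs : + ((n ∸ m) ℕ.* (suc d ℕ.* 1)) ≡ + ℤ.∣ + m ℤ.* + 1 ℤ.+ ℤ.- + n ℤ.* + 1 ∣ ℤ.* + (suc d ℕ.* 1)
      lhs = trans (ℤ.pos-* (n ∸ m) (suc d ℕ.* 1)) (cong (λ t → + t ℤ.* + (suc d ℕ.* 1)) (sym (∣m-n∣≡n∸m m n m≤n)))
      rhs : + (suc p ℕ.* k) ≡ (+[1+ p ] ℤ.* + k) ℤ.* + 1
      rhs = trans (ℤ.pos-* (suc p) k) (sym (ℤ.*-identityʳ (+[1+ p ] ℤ.* + k)))

open Existence using (Ξ-exists)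
open LowerBound using (Ξ-near-double)
open RationalBound using (close-by-denominator)

open import Defs
open import Data.Nat using (ℕ; _≤_; _∸_; _*_)
open import Data.Integer using (+_)
open import Data.Rational using (ℚ; _/_; _-_; ∣_∣; _<_; 0ℚ)
open import Data.Product using (Σ; _×_; _,_)

theorem4 : ((k : ℕ) → 2 ≤ k → Σ ℕ (λ m → IsXi k m × m ≤ 2 * k ∸ 2))
    × ((ε : ℚ) → 0ℚ < ε → Σ ℕ (λ K → (k : ℕ) → K ≤ k → 2 ≤ k → (m : ℕ) → IsXi k m
        → ∣ ((+ m) / 1) - ((+ (2 * k)) / 1) ∣ < ε Data.Rational.* ((+ k) / 1)))
theorem4 = Ξ-exists , λ ε 0<ε →
  let (Q , 1≤Q , close) = close-by-denominator ε 0<ε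
      (K , near) = Ξ-near-double Q 1≤Q
  in K , λ k K≤k 2≤k m Ξk≡m → let (m≤2k , gap<k) = near k K≤k 2≤k m Ξk≡m in close m (2 * k) k m≤2k gap<k
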